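{- Let $q$ be odd, let $P_n$ be the set of monic square-free polynomials of degree $n$ in $\mathbb{F}_q[x]$, and let $T = T(n)$ be a function of $n$ with $T(n)\to\infty$ and $n - T(n)\to\infty$ as $n\to\infty$. For $f\in P_n$ let $\omega_T(f)$ be the number of irreducible (monic) divisors of $f$ of degree at most $T$, and let $\pi(d)$ be the number of monic irreducible polynomials of degree $d$ over $\mathbb{F}_q$. Then \[ \mu := \frac{1}{\#P_n}\sum_{f\in P_n}\omega_T(f) = \sum_{d \leq T} \frac{\pi(d)}{q^d + 1} + O\!\left(q^{2T - n + 1}\right). \]
   Context: $\#P_n = q^n - q^{n-1}$. -}

module Defs where

open import Data.Nat as ℕ using (ℕ; zero; suc; _≤_; _<_; _∸_; _^_; _≤?_; s≤s; z≤n)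
open import Data.Nat.Properties using (anyUpTo?; ≤-trans; m≤m+n; ≤-refl)
open import Data.List using (List; []; _∷_; _++_; [_]; map; concatMap; filter; length; upTo; foldr)
open import Data.Nat.ListAction using (sum)
open import Data.List.Membership.Propositional using (_∈_)
open import Data.List.Relation.Unary.Any using (Any; here; there; any?)
open import Data.List.Relation.Unary.Unique.Propositional using (Unique)
open import Data.List.Properties using () renaming (≡-dec to list-≡-dec)
open import Data.Vec using (Vec; []; _∷_; toList)
open import Data.Product using (Σ; _×_; _,_; proj₁; proj₂)
open import Data.Integer using (+_)
open import Data.Rational as ℚ using (ℚ; 0ℚ)
open import Relation.Nullary using (Dec; yes; no; ¬_)
open import Relation.Nullary.Decidable using (_×-dec_; ¬?; map′)
open import Relation.Binary.Definitions using (DecidableEquality)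
open import Relation.Binary.PropositionalEquality using (_≡_; _≢_; refl; cong)
import Algebra.Structures as AS

record FiniteField : Set₁ where
  infixl 6 _+_
  infixl 7 _*_
  field
    F          : Set
    _+_ _*_    : F → F → F
    -_         : F → F
    0# 1#      : F
    isCommutativeRing : AS.IsCommutativeRing _≡_ _+_ _*_ -_ 0# 1#
    0≢1        : 0# ≢ 1#
    inverse    : ∀ x → x ≢ 0# → Σ F λ y → x * y ≡ 1#
    _≟_        : DecidableEquality F
    elements   : List F
    complete   : ∀ x → x ∈ elements
    unique     : Unique elements

  order : ℕ
  order = length elements

module Poly (K : FiniteField) where
  open FiniteField K

  -- a polynomial is its list of coefficients, constant term first
  Pol : Set
  Pol = List F

  _⊕_ : Pol → Pol → Pol
  []      ⊕ g       = g
  (a ∷ f) ⊕ []      = a ∷ f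
  (a ∷ f) ⊕ (b ∷ g) = (a + b) ∷ (f ⊕ g)

  _⊛_ : Pol → Pol → Pol
  []      ⊛ g = []
  (a ∷ f) ⊛ g = map (a *_) g ⊕ (0# ∷ (f ⊛ g))

  -- The monic polynomial of degree d with lower coefficients c:
  --   x^d + c₀ + c₁ x + … + c_{d-1} x^{d-1}.
  -- Monic polynomials of degree d are thus in bijection with Vec F d.
  mon : ∀ {d} → Vec F d → Pol
  mon c = toList c ++ [ 1# ]

  allMonic : (d : ℕ) → List (Vec F d)
  allMonic zero    = [] ∷ []
  allMonic (suc d) = concatMap (λ a → map (a ∷_) (allMonic d)) elements

  _∣_ : ∀ {d n} → Vec F d → Vec F n → Set
  _∣_ {d} {n} g f = d ≤ n × Σ (Vec F (n ∸ d)) λ h → mon g ⊛ mon h ≡ mon f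

  NontrivialDivisor : ∀ {d} → Vec F d → Set
  NontrivialDivisor {d} g = Σ ℕ λ e → e < d × (1 ≤ e × Σ (Vec F e) λ h → h ∣ g)

  Irreducible : ∀ {d} → Vec F d → Set
  Irreducible {d} g = 1 ≤ d × ¬ NontrivialDivisor g

  SquareDivisor : ∀ {n} → Vec F n → Set
  SquareDivisor {n} f =
    Σ ℕ λ e → 1 ≤ e × Σ (Vec F e) λ g →
      (2 ℕ.* e ≤ n × Σ (Vec F (n ∸ 2 ℕ.* e)) λ h → (mon g ⊛ mon g) ⊛ mon h ≡ mon f)

  SquareFree : ∀ {n} → Vec F n → Set
  SquareFree f = ¬ SquareDivisor f

  ∃F? : {P : F → Set} → (∀ x → Dec (P x)) → Dec (Σ F P)
  ∃F? {P} P? with any? P? elements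
  ... | yes a = yes (go a)
    where
    go : ∀ {xs} → Any P xs → Σ F P
    go (here {x = x} p) = x , p
    go (there a) = go a
  ... | no ¬a = no λ { (x , p) → ¬a (lift (complete x) p) }
    where
    lift : ∀ {x xs} → x ∈ xs → P x → Any P xs
    lift (here refl) p = here p
    lift (there i) p = there (lift i p)

  ∃Vec? : ∀ k {P : Vec F k → Set} → (∀ v → Dec (P v)) → Dec (Σ (Vec F k) P)
  ∃Vec? zero P? with P? []
  ... | yes p = yes ([] , p)
  ... | no ¬p = no λ { ([] , p) → ¬p p }
  ∃Vec? (suc k) {P} P? =
    map′ (λ { (a , v , p) → (a ∷ v) , p })
         (λ { ((a ∷ v) , p) → a , v , p })
         (∃F? (λ a → ∃Vec? k (λ v → P? (a ∷ v))))

  polDec : DecidableEquality Pol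
  polDec = list-≡-dec _≟_

  _∣?_ : ∀ {d n} (g : Vec F d) (f : Vec F n) → Dec (g ∣ f)
  _∣?_ {d} {n} g f = (d ≤? n) ×-dec ∃Vec? (n ∸ d) (λ h → polDec (mon g ⊛ mon h) (mon f))

  irreducible? : ∀ {d} (g : Vec F d) → Dec (Irreducible g)
  irreducible? {d} g =
    (1 ≤? d) ×-dec ¬? (anyUpTo? (λ e → (1 ≤? e) ×-dec ∃Vec? e (λ h → h ∣? g)) d)

  squareFree? : ∀ {n} (f : Vec F n) → Dec (SquareFree f)
  squareFree? {n} f = ¬? (map′ to from (anyUpTo? P? (suc n)))
    where
    P : ℕ → Set
    P e = 1 ≤ e × Σ (Vec F e) λ g →
      (2 ℕ.* e ≤ n × Σ (Vec F (n ∸ 2 ℕ.* e)) λ h → (mon g ⊛ mon g) ⊛ mon h ≡ mon f)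
    P? : ∀ e → Dec (P e)
    P? e = (1 ≤? e) ×-dec ∃Vec? e (λ g → (2 ℕ.* e ≤? n) ×-dec
             ∃Vec? (n ∸ 2 ℕ.* e) (λ h → polDec ((mon g ⊛ mon g) ⊛ mon h) (mon f)))
    to : Σ ℕ (λ e → e < suc n × P e) → SquareDivisor f
    to (e , _ , p) = e , p
    from : SquareDivisor f → Σ ℕ (λ e → e < suc n × P e)
    from (e , p) = e , s≤s (≤-trans (m≤m+n e (e ℕ.+ 0)) (proj₁ (proj₂ (proj₂ p)))) , p

  P : (n : ℕ) → List (Vec F n)
  P n = filter squareFree? (allMonic n)

  π : ℕ → ℕ
  π d = length (filter irreducible? (allMonic d))

  ω : (T : ℕ) → ∀ {n} → Vec F n → ℕ
  ω T f = sum (map (λ d → length (filter (λ g → irreducible? g ×-dec g ∣? f) (allMonic d)))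
                   (upTo (suc T)))

-- a / b as a rational number (only used with b ≠ 0; value 0 if b = 0)
_/ℕ_ : ℕ → ℕ → ℚ
a /ℕ zero  = 0ℚ
a /ℕ suc b = (+ a) ℚ./ suc b

-- q ^ (a - b) as a rational number, the exponent a - b being an integer
powℤ : (q a b : ℕ) → ℚ
powℤ q a b with b ≤? a
... | yes _ = (q ^ (a ∸ b)) /ℕ 1
... | no  _ = 1 /ℕ (q ^ (b ∸ a))

TendsToInfinity : (ℕ → ℕ) → Set
TendsToInfinity f = ∀ M → Σ ℕ λ N → ∀ n → N ≤ n → M ≤ f n

module Quantities (K : FiniteField) where
  open FiniteField K using (order)
  open Poly K

  μ : (T n : ℕ) → ℚ
  μ T n = sum (map (ω T) (P n)) /ℕ length (P n)

  mainTerm : (T : ℕ) → ℚ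
  mainTerm T = foldr ℚ._+_ 0ℚ (map (λ d → π d /ℕ (order ^ d ℕ.+ 1)) (Data.List.map suc (upTo T)))

-- Swapping the sums, Σ_{f ∈ P_n} ω_T(f) = Σ_{d ≤ T} Σ_g D_g(n), where g runs over the π(d) monic
-- irreducibles of degree d and D_g(m) (resp. A_g(m)) counts the square-free monic f of degree m with
-- g ∣ f (resp. g ∤ f).  Unique factorisation gives D_g(m) + A_g(m) = #P_m and D_g(m) = A_g(m - d)
-- (f ↦ f / g), hence A_g(m) + A_g(m - d) = #P_m.  With #P_m = q^m - q^(m-1) for m ≥ 2 (every monic
-- polynomial is a² b with b square-free and a unique), this recursion gives
-- (q^d + 1) D_g(n) = #P_n + O(q^d).  Dividing by (q^d + 1) #P_n and summing, the error is at most
-- Σ_{d ≤ T} π(d) 2 q^d / #P_n ≤ 4 q^(2T) / q^(n-1).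

module Submission where

open import Defs

module PolynomialArithmetic (K : FiniteField) where

  open import Data.Nat using (ℕ; zero; suc)
  open import Data.List using ([]; _∷_; map)
  open import Relation.Binary.PropositionalEquality
  open import Relation.Binary.Bundles using (Setoid)
  open import Relation.Binary.Structures using (IsEquivalence)
  open import Algebra.Bundles using (CommutativeRing; CommutativeSemigroup)
  import Algebra.Properties.Ring as RingProperties
  import Algebra.Properties.CommutativeSemigroup as CommutativeSemigroupProperties
  open FiniteField K
  open Poly K

  commutativeRing : CommutativeRing _ _
  commutativeRing = record { isCommutativeRing = isCommutativeRing }

  open CommutativeRing commutativeRing public
    using (+-identityˡ; +-identityʳ; zeroˡ; zeroʳ; *-identityˡ; *-identityʳ;
           +-comm; *-comm; +-assoc; *-assoc; distribˡ; distribʳ; -‿inverseʳ)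

  coeff : Pol → ℕ → F
  coeff []      i       = 0#
  coeff (a ∷ f) zero    = a
  coeff (a ∷ f) (suc i) = coeff f i

  -- Coefficient lists are equal as polynomials when they differ by trailing zeros.
  infix 4 _≈_
  record _≈_ (f g : Pol) : Set where
    constructor ⟨_⟩
    field at : ∀ i → coeff f i ≡ coeff g i
  open _≈_ public

  ≈-refl : ∀ {f} → f ≈ f
  ≈-refl = ⟨ (λ i → refl) ⟩

  ≈-sym : ∀ {f g} → f ≈ g → g ≈ f
  ≈-sym p = ⟨ (λ i → sym (at p i)) ⟩

  ≈-trans : ∀ {f g h} → f ≈ g → g ≈ h → f ≈ h
  ≈-trans p q = ⟨ (λ i → trans (at p i) (at q i)) ⟩

  ≈-reflexive : ∀ {f g} → f ≡ g → f ≈ g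
  ≈-reflexive refl = ≈-refl

  ≈-isEquivalence : IsEquivalence _≈_
  ≈-isEquivalence = record { refl = ≈-refl ; sym = ≈-sym ; trans = ≈-trans }

  ≈-setoid : Setoid _ _
  ≈-setoid = record { isEquivalence = ≈-isEquivalence }

  ∷-cong : ∀ {a b f g} → a ≡ b → f ≈ g → (a ∷ f) ≈ (b ∷ g)
  ∷-cong p q = ⟨ (λ { zero → p ; (suc i) → at q i }) ⟩

  ∷-injectiveˡ : ∀ {a b f g} → (a ∷ f) ≈ (b ∷ g) → a ≡ b
  ∷-injectiveˡ p = at p zero

  ∷-injectiveʳ : ∀ {a b f g} → (a ∷ f) ≈ (b ∷ g) → f ≈ g
  ∷-injectiveʳ p = ⟨ (λ i → at p (suc i)) ⟩

  0∷-≈[] : ∀ {h} → h ≈ [] → (0# ∷ h) ≈ []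
  0∷-≈[] p = ⟨ (λ { zero → refl ; (suc i) → at p i }) ⟩

  ≈[]-head : ∀ {b g} → [] ≈ (b ∷ g) → 0# ≡ b
  ≈[]-head p = at p zero

  ≈[]-tail : ∀ {b g} → [] ≈ (b ∷ g) → [] ≈ g
  ≈[]-tail p = ⟨ (λ i → at p (suc i)) ⟩

  scale : F → Pol → Pol
  scale c f = map (c *_) f

  coeff-⊕ : ∀ f g i → coeff (f ⊕ g) i ≡ coeff f i + coeff g i
  coeff-⊕ []      g       i       = sym (+-identityˡ _)
  coeff-⊕ (a ∷ f) []      i       = sym (+-identityʳ _)
  coeff-⊕ (a ∷ f) (b ∷ g) zero    = refl
  coeff-⊕ (a ∷ f) (b ∷ g) (suc i) = coeff-⊕ f g i

  coeff-scale : ∀ c f i → coeff (scale c f) i ≡ c * coeff f i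
  coeff-scale c []      i       = sym (zeroʳ c)
  coeff-scale c (a ∷ f) zero    = refl
  coeff-scale c (a ∷ f) (suc i) = coeff-scale c f i

  ⊕-cong : ∀ {f f′ g g′} → f ≈ f′ → g ≈ g′ → (f ⊕ g) ≈ (f′ ⊕ g′)
  ⊕-cong {f} {f′} {g} {g′} p q = ⟨ (λ i → begin
    coeff (f ⊕ g) i           ≡⟨ coeff-⊕ f g i ⟩
    coeff f i + coeff g i     ≡⟨ cong₂ _+_ (at p i) (at q i) ⟩
    coeff f′ i + coeff g′ i   ≡⟨ coeff-⊕ f′ g′ i ⟨
    coeff (f′ ⊕ g′) i         ∎) ⟩
    where open ≡-Reasoning

  ⊕-comm : ∀ f g → (f ⊕ g) ≈ (g ⊕ f)
  ⊕-comm f g = ⟨ (λ i → trans (coeff-⊕ f g i) (trans (+-comm _ _) (sym (coeff-⊕ g f i)))) ⟩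

  ⊕-assoc : ∀ f g h → ((f ⊕ g) ⊕ h) ≈ (f ⊕ (g ⊕ h))
  ⊕-assoc f g h = ⟨ (λ i → begin
    coeff ((f ⊕ g) ⊕ h) i                 ≡⟨ coeff-⊕ (f ⊕ g) h i ⟩
    coeff (f ⊕ g) i + coeff h i           ≡⟨ cong (_+ coeff h i) (coeff-⊕ f g i) ⟩
    (coeff f i + coeff g i) + coeff h i   ≡⟨ +-assoc _ _ _ ⟩
    coeff f i + (coeff g i + coeff h i)   ≡⟨ cong (coeff f i +_) (coeff-⊕ g h i) ⟨
    coeff f i + coeff (g ⊕ h) i           ≡⟨ coeff-⊕ f (g ⊕ h) i ⟨
    coeff (f ⊕ (g ⊕ h)) i                 ∎) ⟩
    where open ≡-Reasoning

  ⊕-identityʳ : ∀ f → (f ⊕ []) ≈ f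
  ⊕-identityʳ f = ⟨ (λ i → trans (coeff-⊕ f [] i) (+-identityʳ _)) ⟩

  ⊕-≈[]ʳ : ∀ f {g} → g ≈ [] → (f ⊕ g) ≈ f
  ⊕-≈[]ʳ f p = ≈-trans (⊕-cong (≈-refl {f}) p) (⊕-identityʳ f)

  ⊕-≈[]ˡ : ∀ {f} g → f ≈ [] → (f ⊕ g) ≈ g
  ⊕-≈[]ˡ g p = ⊕-cong p (≈-refl {g})

  ⊕-commutativeSemigroup : CommutativeSemigroup _ _
  ⊕-commutativeSemigroup = record
    { _≈_ = _≈_ ; _∙_ = _⊕_
    ; isCommutativeSemigroup = record
      { isSemigroup = record
        { isMagma = record { isEquivalence = ≈-isEquivalence ; ∙-cong = ⊕-cong }
        ; assoc = ⊕-assoc }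
      ; comm = ⊕-comm } }

  module ⊕ = CommutativeSemigroupProperties ⊕-commutativeSemigroup

  scale-cong : ∀ c {f g} → f ≈ g → scale c f ≈ scale c g
  scale-cong c {f} {g} p = ⟨ (λ i → trans (coeff-scale c f i) (trans (cong (c *_) (at p i)) (sym (coeff-scale c g i)))) ⟩

  scale-congˡ : ∀ {c d} f → c ≡ d → scale c f ≈ scale d f
  scale-congˡ f refl = ≈-refl

  scale-⊕ : ∀ c f g → scale c (f ⊕ g) ≈ (scale c f ⊕ scale c g)
  scale-⊕ c f g = ⟨ (λ i → begin
    coeff (scale c (f ⊕ g)) i                      ≡⟨ coeff-scale c (f ⊕ g) i ⟩
    c * coeff (f ⊕ g) i                            ≡⟨ cong (c *_) (coeff-⊕ f g i) ⟩
    c * (coeff f i + coeff g i)                    ≡⟨ distribˡ _ _ _ ⟩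
    c * coeff f i + c * coeff g i                  ≡⟨ cong₂ _+_ (coeff-scale c f i) (coeff-scale c g i) ⟨
    coeff (scale c f) i + coeff (scale c g) i      ≡⟨ coeff-⊕ (scale c f) (scale c g) i ⟨
    coeff (scale c f ⊕ scale c g) i                ∎) ⟩
    where open ≡-Reasoning

  scale-+ : ∀ a b h → scale (a + b) h ≈ (scale a h ⊕ scale b h)
  scale-+ a b h = ⟨ (λ i → begin
    coeff (scale (a + b) h) i                      ≡⟨ coeff-scale (a + b) h i ⟩
    (a + b) * coeff h i                            ≡⟨ distribʳ _ _ _ ⟩
    a * coeff h i + b * coeff h i                  ≡⟨ cong₂ _+_ (coeff-scale a h i) (coeff-scale b h i) ⟨
    coeff (scale a h) i + coeff (scale b h) i      ≡⟨ coeff-⊕ (scale a h) (scale b h) i ⟨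
    coeff (scale a h ⊕ scale b h) i                ∎) ⟩
    where open ≡-Reasoning

  scale-scale : ∀ c d f → scale c (scale d f) ≈ scale (c * d) f
  scale-scale c d f = ⟨ (λ i → begin
    coeff (scale c (scale d f)) i   ≡⟨ coeff-scale c (scale d f) i ⟩
    c * coeff (scale d f) i         ≡⟨ cong (c *_) (coeff-scale d f i) ⟩
    c * (d * coeff f i)             ≡⟨ *-assoc c d (coeff f i) ⟨
    (c * d) * coeff f i             ≡⟨ coeff-scale (c * d) f i ⟨
    coeff (scale (c * d) f) i       ∎) ⟩
    where open ≡-Reasoning

  scale-0 : ∀ f → scale 0# f ≈ []
  scale-0 f = ⟨ (λ i → trans (coeff-scale 0# f i) (zeroˡ _)) ⟩

  scale-1 : ∀ f → scale 1# f ≈ f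
  scale-1 f = ⟨ (λ i → trans (coeff-scale 1# f i) (*-identityˡ _)) ⟩

  ⊛-zeroʳ : ∀ f → (f ⊛ []) ≈ []
  ⊛-zeroʳ []      = ≈-refl
  ⊛-zeroʳ (a ∷ f) = 0∷-≈[] (⊛-zeroʳ f)

  ⊛-congˡ : ∀ {f f′} g → f ≈ f′ → (f ⊛ g) ≈ (f′ ⊛ g)
  ⊛-congˡ {[]}    {[]}     g p = ≈-refl
  ⊛-congˡ {[]}    {b ∷ f′} g p with ≈[]-head p
  ... | refl = ≈-sym (≈-trans (⊕-≈[]ˡ _ (scale-0 g)) (0∷-≈[] (≈-sym (⊛-congˡ g (≈[]-tail p)))))
  ⊛-congˡ {a ∷ f} {[]}     g p with ≈[]-head (≈-sym p)
  ... | refl = ≈-trans (⊕-≈[]ˡ _ (scale-0 g)) (0∷-≈[] (⊛-congˡ g (≈-sym (≈[]-tail (≈-sym p)))))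
  ⊛-congˡ {a ∷ f} {b ∷ f′} g p with ∷-injectiveˡ p
  ... | refl = ⊕-cong (≈-refl {scale a g}) (∷-cong refl (⊛-congˡ g (∷-injectiveʳ p)))

  ⊛-∷ʳ : ∀ f b g → (f ⊛ (b ∷ g)) ≈ (scale b f ⊕ (0# ∷ (f ⊛ g)))
  ⊛-∷ʳ []      b g = ≈-sym (0∷-≈[] ≈-refl)
  ⊛-∷ʳ (a ∷ f) b g =
    ∷-cong (trans (+-identityʳ _) (trans (*-comm a b) (sym (+-identityʳ _))))
      (≈-trans (⊕-cong (≈-refl {scale a g}) (⊛-∷ʳ f b g)) (⊕.x∙yz≈y∙xz (scale a g) (scale b f) (0# ∷ (f ⊛ g))))

  ⊛-comm : ∀ f g → (f ⊛ g) ≈ (g ⊛ f)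
  ⊛-comm []      g = ≈-sym (⊛-zeroʳ g)
  ⊛-comm (a ∷ f) g = ≈-trans (⊕-cong (≈-refl {scale a g}) (∷-cong refl (⊛-comm f g))) (≈-sym (⊛-∷ʳ g a f))

  ⊛-congʳ : ∀ f {g g′} → g ≈ g′ → (f ⊛ g) ≈ (f ⊛ g′)
  ⊛-congʳ f {g} {g′} p = ≈-trans (⊛-comm f g) (≈-trans (⊛-congˡ f p) (⊛-comm g′ f))

  ⊛-cong : ∀ {f f′ g g′} → f ≈ f′ → g ≈ g′ → (f ⊛ g) ≈ (f′ ⊛ g′)
  ⊛-cong {f} {f′} {g} {g′} p q = ≈-trans (⊛-congˡ g p) (⊛-congʳ f′ q)

  ⊛-distribʳ : ∀ f g h → ((f ⊕ g) ⊛ h) ≈ ((f ⊛ h) ⊕ (g ⊛ h))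
  ⊛-distribʳ []      g       h = ≈-refl
  ⊛-distribʳ (a ∷ f) []      h = ≈-sym (⊕-identityʳ _)
  ⊛-distribʳ (a ∷ f) (b ∷ g) h =
    ≈-trans (⊕-cong (scale-+ a b h) (∷-cong (sym (+-identityʳ 0#)) (⊛-distribʳ f g h)))
      (⊕.interchange (scale a h) (scale b h) (0# ∷ (f ⊛ h)) (0# ∷ (g ⊛ h)))

  ⊛-distribˡ : ∀ f g h → (h ⊛ (f ⊕ g)) ≈ ((h ⊛ f) ⊕ (h ⊛ g))
  ⊛-distribˡ f g h = ≈-trans (⊛-comm h (f ⊕ g)) (≈-trans (⊛-distribʳ f g h) (⊕-cong (⊛-comm f h) (⊛-comm g h)))

  scale-⊛ : ∀ c f g → (scale c f ⊛ g) ≈ scale c (f ⊛ g)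
  scale-⊛ c []      g = ≈-refl
  scale-⊛ c (a ∷ f) g =
    ≈-trans (⊕-cong (≈-sym (scale-scale c a g)) (∷-cong (sym (zeroʳ c)) (scale-⊛ c f g)))
      (≈-sym (scale-⊕ c (scale a g) (0# ∷ (f ⊛ g))))

  ⊛-scale : ∀ c f g → (f ⊛ scale c g) ≈ scale c (f ⊛ g)
  ⊛-scale c f g = ≈-trans (⊛-comm f (scale c g)) (≈-trans (scale-⊛ c g f) (scale-cong c (⊛-comm g f)))

  ⊛-assoc : ∀ f g h → ((f ⊛ g) ⊛ h) ≈ (f ⊛ (g ⊛ h))
  ⊛-assoc []      g h = ≈-refl
  ⊛-assoc (a ∷ f) g h =
    ≈-trans (⊛-distribʳ (scale a g) (0# ∷ (f ⊛ g)) h)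
      (⊕-cong (scale-⊛ a g h) (≈-trans (⊕-≈[]ˡ _ (scale-0 h)) (∷-cong refl (⊛-assoc f g h))))

  ⊛-commutativeSemigroup : CommutativeSemigroup _ _
  ⊛-commutativeSemigroup = record
    { _≈_ = _≈_ ; _∙_ = _⊛_
    ; isCommutativeSemigroup = record
      { isSemigroup = record
        { isMagma = record { isEquivalence = ≈-isEquivalence ; ∙-cong = ⊛-cong }
        ; assoc = ⊛-assoc }
      ; comm = ⊛-comm } }

  module ⊛ = CommutativeSemigroupProperties ⊛-commutativeSemigroup

  ⊛-identityˡ : ∀ g → ((1# ∷ []) ⊛ g) ≈ g
  ⊛-identityˡ g = ≈-trans (⊕-cong (scale-1 g) (0∷-≈[] ≈-refl)) (⊕-identityʳ g)

  ⊛-identityʳ : ∀ g → (g ⊛ (1# ∷ [])) ≈ g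
  ⊛-identityʳ g = ≈-trans (⊛-comm g _) (⊛-identityˡ g)

  ⊛-≈[] : ∀ f {g} → g ≈ [] → (f ⊛ g) ≈ []
  ⊛-≈[] f p = ≈-trans (⊛-congʳ f p) (⊛-zeroʳ f)

  neg : Pol → Pol
  neg f = scale (- 1#) f

  coeff-neg : ∀ f i → coeff (neg f) i ≡ - coeff f i
  coeff-neg f i = trans (coeff-scale (- 1#) f i) (-1*x≈-x _)
    where open RingProperties (CommutativeRing.ring commutativeRing) using (-1*x≈-x)

  ⊕-inverseʳ : ∀ f → (f ⊕ neg f) ≈ []
  ⊕-inverseʳ f = ⟨ (λ i → trans (coeff-⊕ f (neg f) i) (trans (cong (coeff f i +_) (coeff-neg f i)) (-‿inverseʳ _))) ⟩

  ⊕-inverseˡ : ∀ f → (neg f ⊕ f) ≈ []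
  ⊕-inverseˡ f = ≈-trans (⊕-comm (neg f) f) (⊕-inverseʳ f)

  neg-cong : ∀ {f g} → f ≈ g → neg f ≈ neg g
  neg-cong = scale-cong (- 1#)

  ⊛-neg : ∀ f g → (f ⊛ neg g) ≈ neg (f ⊛ g)
  ⊛-neg f g = ⊛-scale (- 1#) f g

  neg-⊛ : ∀ f g → (neg f ⊛ g) ≈ neg (f ⊛ g)
  neg-⊛ f g = scale-⊛ (- 1#) f g

  ⊕-neg-moveˡ : ∀ f g h → f ≈ (g ⊕ h) → (f ⊕ neg g) ≈ h
  ⊕-neg-moveˡ f g h p = ≈-trans (⊕-cong (≈-trans p (⊕-comm g h)) (≈-refl {neg g}))
    (≈-trans (⊕-assoc h g (neg g)) (⊕-≈[]ʳ h (⊕-inverseʳ g)))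

  ⊕-neg-≈[]⇒≈ : ∀ f g → (f ⊕ neg g) ≈ [] → f ≈ g
  ⊕-neg-≈[]⇒≈ f g p = ≈-trans (≈-sym (⊕-≈[]ʳ f (⊕-inverseˡ g)))
    (≈-trans (≈-sym (⊕-assoc f (neg g) g)) (⊕-≈[]ˡ g p))


module Degree (K : FiniteField) where

  open import Data.Nat as ℕ using (ℕ; zero; suc; _≤_; _<_; z≤n; s≤s; _∸_)
  import Data.Nat.Properties as ℕₚ
  open import Data.List using ([]; _∷_; _++_; [_]; length)
  open import Data.Vec using (Vec; []; _∷_; toList)
  open import Data.Product using (_×_; _,_; proj₁; proj₂)
  open import Data.Sum using (inj₁; inj₂)
  open import Relation.Nullary using (¬_; yes; no)
  open import Relation.Binary.Definitions using (tri<; tri≈; tri>)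
  open import Relation.Binary.PropositionalEquality hiding ([_])
  open FiniteField K
  open Poly K
  open PolynomialArithmetic K

  DegreeBelow : Pol → ℕ → Set
  DegreeBelow f k = ∀ i → k ≤ i → coeff f i ≡ 0#

  DegreeBelow-mono : ∀ {f j k} → j ≤ k → DegreeBelow f j → DegreeBelow f k
  DegreeBelow-mono j≤k b i k≤i = b i (ℕₚ.≤-trans j≤k k≤i)

  DegreeBelow-resp-≈ : ∀ {f g k} → f ≈ g → DegreeBelow f k → DegreeBelow g k
  DegreeBelow-resp-≈ p b i k≤i = trans (sym (at p i)) (b i k≤i)

  DegreeBelow-length : ∀ f → DegreeBelow f (length f)
  DegreeBelow-length []      i       _        = refl
  DegreeBelow-length (a ∷ f) (suc i) (s≤s le) = DegreeBelow-length f i le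

  DegreeBelow-0⇒≈[] : ∀ {f} → DegreeBelow f 0 → f ≈ []
  DegreeBelow-0⇒≈[] b = ⟨ (λ i → b i z≤n) ⟩

  coeff-++-< : ∀ {d} (v : Vec F d) g i → i < d → coeff (toList v ++ g) i ≡ coeff (toList v) i
  coeff-++-< (a ∷ v) g zero    _        = refl
  coeff-++-< (a ∷ v) g (suc i) (s≤s le) = coeff-++-< v g i le

  coeff-++-+ : ∀ {d} (v : Vec F d) g i → coeff (toList v ++ g) (d ℕ.+ i) ≡ coeff g i
  coeff-++-+ []      g i = refl
  coeff-++-+ (a ∷ v) g i = coeff-++-+ v g i

  coeff-++-≥ : ∀ {d} (v : Vec F d) g i → d ≤ i → coeff (toList v ++ g) i ≡ coeff g (i ∸ d)
  coeff-++-≥ {d} v g i le = trans (cong (coeff (toList v ++ g)) (sym (ℕₚ.m+[n∸m]≡n le))) (coeff-++-+ v g (i ∸ d))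

  coeff-mon-degree : ∀ {d} (v : Vec F d) → coeff (mon v) d ≡ 1#
  coeff-mon-degree {d} v = trans (cong (coeff (mon v)) (sym (ℕₚ.+-identityʳ d))) (coeff-++-+ v [ 1# ] 0)

  mon-DegreeBelow : ∀ {d} (v : Vec F d) → DegreeBelow (mon v) (suc d)
  mon-DegreeBelow {d} v i le =
    trans (coeff-++-≥ v [ 1# ] i (ℕₚ.≤-trans (ℕₚ.n≤1+n d) le)) (coeff-[1#] (i ∸ d) (ℕₚ.m<n⇒0<n∸m le))
    where
    coeff-[1#] : ∀ j → 0 < j → coeff [ 1# ] j ≡ 0#
    coeff-[1#] (suc j) _ = refl

  coeff-∷-⊛ : ∀ c f g i → coeff ((c ∷ f) ⊛ g) i ≡ c * coeff g i + coeff (0# ∷ (f ⊛ g)) i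
  coeff-∷-⊛ c f g i = trans (coeff-⊕ (scale c g) (0# ∷ (f ⊛ g)) i) (cong (_+ coeff (0# ∷ (f ⊛ g)) i) (coeff-scale c g i))

  private
    c*0+0≡0 : ∀ c → c * 0# + 0# ≡ 0#
    c*0+0≡0 c = trans (+-identityʳ _) (zeroʳ c)

  ⊛-DegreeBelow : ∀ f g a b → DegreeBelow f (suc a) → DegreeBelow g (suc b) →
                  DegreeBelow (f ⊛ g) (suc (a ℕ.+ b)) × coeff (f ⊛ g) (a ℕ.+ b) ≡ coeff f a * coeff g b
  ⊛-DegreeBelow []      g a       b bf bg = (λ i _ → refl) , sym (zeroˡ _)
  ⊛-DegreeBelow (c ∷ f) g zero    b bf bg =
    (λ i le → trans (coeff-∷-⊛ c f g i) (trans (cong₂ _+_ (cong (c *_) (bg i le)) (at fg≈[] i)) (c*0+0≡0 c))) ,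
    trans (coeff-∷-⊛ c f g b) (trans (cong (c * coeff g b +_) (at fg≈[] b)) (+-identityʳ _))
    where
    fg≈[] : (0# ∷ (f ⊛ g)) ≈ []
    fg≈[] = 0∷-≈[] (⊛-congˡ {f} {[]} g ⟨ (λ i → bf (suc i) (s≤s z≤n)) ⟩)
  ⊛-DegreeBelow (c ∷ f) g (suc a) b bf bg = below , leading
    where
    ih = ⊛-DegreeBelow f g a b (λ i le → bf (suc i) (s≤s le)) bg
    below : DegreeBelow ((c ∷ f) ⊛ g) (suc (suc (a ℕ.+ b)))
    below (suc i) (s≤s le) =
      trans (coeff-∷-⊛ c f g (suc i))
        (trans (cong₂ _+_ (cong (c *_) (bg (suc i) (s≤s (ℕₚ.≤-trans (ℕₚ.m≤n+m b a) (ℕₚ.≤-trans (ℕₚ.n≤1+n _) le)))))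
                          (proj₁ ih i le))
               (c*0+0≡0 c))
    leading : coeff ((c ∷ f) ⊛ g) (suc (a ℕ.+ b)) ≡ coeff f a * coeff g b
    leading =
      trans (coeff-∷-⊛ c f g (suc (a ℕ.+ b)))
        (trans (cong₂ _+_ (cong (c *_) (bg _ (s≤s (ℕₚ.m≤n+m b a)))) (proj₂ ih))
               (trans (cong (_+ (coeff f a * coeff g b)) (zeroʳ c)) (+-identityˡ _)))

  data Leading (f : Pol) (k : ℕ) : Set where
    zeroPoly : f ≈ [] → Leading f k
    leadingAt : ∀ j → j < k → coeff f j ≢ 0# → DegreeBelow f (suc j) → Leading f k

  leading : ∀ f k → DegreeBelow f k → Leading f k
  leading f zero    b = zeroPoly (DegreeBelow-0⇒≈[] b)
  leading f (suc k) b with coeff f k ≟ 0#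
  ... | no ≢0 = leadingAt k ℕₚ.≤-refl ≢0 b
  ... | yes ≡0 with leading f k below-k
    where
    below-k : DegreeBelow f k
    below-k i le with ℕₚ.m≤n⇒m<n∨m≡n le
    ... | inj₁ lt   = b i lt
    ... | inj₂ refl = ≡0
  ...   | zeroPoly z            = zeroPoly z
  ...   | leadingAt j lt ≢0 bj = leadingAt j (ℕₚ.m≤n⇒m≤1+n lt) ≢0 bj

  ≢0⇒≉[] : ∀ {f j} → coeff f j ≢ 0# → ¬ (f ≈ [])
  ≢0⇒≉[] ≢0 z = ≢0 (at z _)

  tabulate : ∀ j → (ℕ → F) → Vec F j
  tabulate zero    h = []
  tabulate (suc j) h = h 0 ∷ tabulate j (λ i → h (suc i))

  coeff-tabulate : ∀ j h i → i < j → coeff (toList (tabulate j h)) i ≡ h i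
  coeff-tabulate (suc j) h zero    _        = refl
  coeff-tabulate (suc j) h (suc i) (s≤s le) = coeff-tabulate j (λ i → h (suc i)) i le

  tabulate-cong : ∀ j {h h′} → (∀ i → h i ≡ h′ i) → tabulate j h ≡ tabulate j h′
  tabulate-cong zero    p = refl
  tabulate-cong (suc j) p = cong₂ _∷_ (p 0) (tabulate-cong j (λ i → p (suc i)))

  tabulate-coeff-mon : ∀ {d} (v : Vec F d) → tabulate d (coeff (mon v)) ≡ v
  tabulate-coeff-mon []      = refl
  tabulate-coeff-mon (c ∷ v) = cong (c ∷_) (tabulate-coeff-mon v)

  mon-injective : ∀ {d} {v w : Vec F d} → mon v ≈ mon w → v ≡ w
  mon-injective {d} {v} {w} p =
    trans (sym (tabulate-coeff-mon v)) (trans (tabulate-cong d (at p)) (tabulate-coeff-mon w))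

  inv : ∀ c → c ≢ 0# → F
  inv c ≢0 = proj₁ (inverse c ≢0)

  *-inv : ∀ c (≢0 : c ≢ 0#) x → c * (inv c ≢0 * x) ≡ x
  *-inv c ≢0 x = trans (sym (*-assoc _ _ _)) (trans (cong (_* x) (proj₂ (inverse c ≢0))) (*-identityˡ x))

  monicPart : ∀ f j → coeff f j ≢ 0# → Vec F j
  monicPart f j ≢0 = tabulate j (λ i → inv (coeff f j) ≢0 * coeff f i)

  ≈-scale-monicPart : ∀ f j (≢0 : coeff f j ≢ 0#) → DegreeBelow f (suc j) →
                      f ≈ scale (coeff f j) (mon (monicPart f j ≢0))
  ≈-scale-monicPart f j ≢0 b = ⟨ coeff-≡ ⟩
    where
    c = coeff f j
    w = monicPart f j ≢0
    coeff-≡ : ∀ i → coeff f i ≡ coeff (scale c (mon w)) i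
    coeff-≡ i with ℕₚ.<-cmp i j
    ... | tri< lt _ _ = sym (trans (coeff-scale c (mon w) i)
                          (trans (cong (c *_) (trans (coeff-++-< w [ 1# ] i lt) (coeff-tabulate j _ i lt))) (*-inv c ≢0 _)))
    ... | tri≈ _ refl _ = sym (trans (coeff-scale c (mon w) i) (trans (cong (c *_) (coeff-mon-degree w)) (*-identityʳ c)))
    ... | tri> _ _ gt = trans (b i gt) (sym (trans (coeff-scale c (mon w) i) (trans (cong (c *_) (mon-DegreeBelow w i gt)) (zeroʳ c))))


module Divisibility (K : FiniteField) where

  open import Data.Nat as ℕ using (zero; suc; _≤_; _<_; z≤n; s≤s)
  import Data.Nat.Properties as ℕₚ
  open import Data.List using ([]; _∷_)
  open import Data.Vec using (Vec; []; _∷_)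
  open import Data.Product using (Σ; _×_; _,_; proj₂)
  open import Data.Sum using (inj₁; inj₂)
  open import Data.Empty using (⊥-elim)
  open import Relation.Nullary using (¬_)
  open import Relation.Binary.PropositionalEquality hiding ([_])
  open FiniteField K
  open Poly K
  open PolynomialArithmetic K
  open Degree K

  infix 4 _∣ₚ_
  record _∣ₚ_ (g f : Pol) : Set where
    constructor _,_
    field
      quotient : Pol
      equation : f ≈ (g ⊛ quotient)

  ∣ₚ-refl : ∀ A → A ∣ₚ A
  ∣ₚ-refl A = (1# ∷ []) , ≈-sym (⊛-identityʳ A)

  ∣ₚ-⊛ʳ : ∀ A C → A ∣ₚ (A ⊛ C)
  ∣ₚ-⊛ʳ A C = C , ≈-refl

  ∣ₚ-trans : ∀ {A B C} → A ∣ₚ B → B ∣ₚ C → A ∣ₚ C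
  ∣ₚ-trans {A} (t , e) (s , e′) = (t ⊛ s) , ≈-trans e′ (≈-trans (⊛-congˡ s e) (⊛-assoc A t s))

  ∣ₚ-⊛ : ∀ {A B} C → A ∣ₚ B → A ∣ₚ (B ⊛ C)
  ∣ₚ-⊛ C D = ∣ₚ-trans D (∣ₚ-⊛ʳ _ C)

  ∣ₚ-respʳ : ∀ {A B B′} → B ≈ B′ → A ∣ₚ B → A ∣ₚ B′
  ∣ₚ-respʳ p (t , e) = t , ≈-trans (≈-sym p) e

  ∣ₚ-⊛ˡ : ∀ {A B} C → A ∣ₚ B → A ∣ₚ (C ⊛ B)
  ∣ₚ-⊛ˡ {B = B} C D = ∣ₚ-respʳ (⊛-comm B C) (∣ₚ-⊛ C D)

  ∣ₚ-respˡ : ∀ {A A′ B} → A ≈ A′ → A ∣ₚ B → A′ ∣ₚ B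
  ∣ₚ-respˡ {A} {A′} p (t , e) = t , ≈-trans e (⊛-congˡ t p)

  ∣ₚ-⊛-⊛ : ∀ {A B C D} → A ∣ₚ B → C ∣ₚ D → (A ⊛ C) ∣ₚ (B ⊛ D)
  ∣ₚ-⊛-⊛ {A} {C = C} (t , e) (s , e′) = (t ⊛ s) , ≈-trans (⊛-cong e e′) (⊛.interchange A t C s)

  ∣ₚ-difference : ∀ {P x y z} → P ∣ₚ y → P ∣ₚ z → x ≈ (y ⊕ neg z) → P ∣ₚ x
  ∣ₚ-difference {P} (a , ey) (c , ez) e =
    (a ⊕ neg c) , ≈-trans e (≈-trans (⊕-cong ey (≈-trans (neg-cong ez) (≈-sym (⊛-neg P c))))
                                     (≈-sym (⊛-distribˡ a (neg c) P)))

  ∣ₚ-unscale : ∀ {P} W {b c} → c ≢ 0# → P ∣ₚ (scale c W ⊛ b) → P ∣ₚ (W ⊛ b)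
  ∣ₚ-unscale {P} W {b} {c} ≢0 (t , e) = scale c⁻¹ t , (begin
    W ⊛ b                         ≈⟨ scale-1 (W ⊛ b) ⟨
    scale 1# (W ⊛ b)              ≈⟨ scale-congˡ (W ⊛ b) (trans (*-comm c⁻¹ c) (proj₂ (inverse c ≢0))) ⟨
    scale (c⁻¹ * c) (W ⊛ b)       ≈⟨ scale-scale c⁻¹ c (W ⊛ b) ⟨
    scale c⁻¹ (scale c (W ⊛ b))   ≈⟨ scale-cong c⁻¹ (≈-trans (≈-sym (scale-⊛ c W b)) e) ⟩
    scale c⁻¹ (P ⊛ t)             ≈⟨ ⊛-scale c⁻¹ P t ⟨
    P ⊛ scale c⁻¹ t               ∎)
    where
    open import Relation.Binary.Reasoning.Setoid ≈-setoid
    c⁻¹ = inv c ≢0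

  divideByMonic : ∀ {d} (g : Vec F d) f →
                  Σ Pol λ t → Σ Pol λ r → DegreeBelow r d × f ≈ ((mon g ⊛ t) ⊕ r)
  divideByMonic [] f = f , [] , (λ i _ → refl) , ≈-sym (≈-trans (⊕-identityʳ _) (⊛-identityˡ f))
  divideByMonic {suc d} g [] = [] , [] , (λ i _ → refl) , ≈-sym (≈-trans (⊕-identityʳ _) (⊛-zeroʳ (mon g)))
  divideByMonic {suc d} g (a ∷ f) with divideByMonic g f
  ... | t , r , r<d , f≈gt+r = (c ∷ t) , r′ , r′<d , eq
    where
    G = mon g
    c = coeff r d
    r′ = (a ∷ r) ⊕ neg (scale c G)
    eq : (a ∷ f) ≈ ((G ⊛ (c ∷ t)) ⊕ r′)
    eq = ≈-sym (≈-trans (⊕-cong (⊛-∷ʳ G c t) (⊕-comm (a ∷ r) (neg (scale c G))))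
           (≈-trans (⊕.interchange (scale c G) (0# ∷ (G ⊛ t)) (neg (scale c G)) (a ∷ r))
           (≈-trans (⊕-≈[]ˡ _ (⊕-inverseʳ (scale c G))) (∷-cong (+-identityˡ a) (≈-sym f≈gt+r)))))
    coeff-r : ∀ i → d ≤ i → coeff r i ≡ c * coeff G (suc i)
    coeff-r i le with ℕₚ.m≤n⇒m<n∨m≡n le
    ... | inj₁ lt   = trans (r<d i lt) (sym (trans (cong (c *_) (mon-DegreeBelow g (suc i) (s≤s lt))) (zeroʳ c)))
    ... | inj₂ refl = sym (trans (cong (c *_) (coeff-mon-degree g)) (*-identityʳ c))
    r′<d : DegreeBelow r′ (suc d)
    r′<d (suc i) (s≤s le) =
      trans (coeff-⊕ (a ∷ r) (neg (scale c G)) (suc i))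
        (trans (cong₂ _+_ (coeff-r i le) (trans (coeff-neg (scale c G) (suc i)) (cong -_ (coeff-scale c G (suc i)))))
               (-‿inverseʳ _))

  ⊛-⊕-neg : ∀ x y b → ((x ⊕ neg y) ⊛ b) ≈ ((x ⊛ b) ⊕ neg (y ⊛ b))
  ⊛-⊕-neg x y b = ≈-trans (⊛-distribʳ x (neg y) b) (⊕-cong (≈-refl {x ⊛ b}) (neg-⊛ y b))

  ∣ₚ-remainder : ∀ {P a b} x y {r} → P ∣ₚ (a ⊛ b) → P ∣ₚ (y ⊛ b) → a ≈ ((x ⊛ y) ⊕ r) → P ∣ₚ (r ⊛ b)
  ∣ₚ-remainder {P} {a} {b} x y {r} P∣ab P∣yb a≈xy+r =
    ∣ₚ-difference P∣ab P∣xyb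
      (≈-trans (⊛-congˡ b (≈-sym (⊕-neg-moveˡ a (x ⊛ y) r a≈xy+r))) (⊛-⊕-neg a (x ⊛ y) b))
    where
    P∣xyb : P ∣ₚ ((x ⊛ y) ⊛ b)
    P∣xyb = ∣ₚ-respʳ (≈-sym (⊛-assoc x y b)) (∣ₚ-⊛ˡ x P∣yb)

  module EuclidsLemma {d} (p : Vec F d)
    (noProperFactor : ∀ {j} (w : Vec F j) → 1 ≤ j → j < d → ¬ (mon w ∣ₚ mon p)) where

    -- Replace r by its monic part w and p by its remainder modulo w, which is nonzero
    -- (w is no proper factor of p) and of smaller degree.
    cancel-lowDegree : ∀ k r b → DegreeBelow r k → k ≤ d → ¬ (r ≈ []) → mon p ∣ₚ (r ⊛ b) → mon p ∣ₚ b
    cancel-lowDegree zero r b r<0 _ r≉[] _ = ⊥-elim (r≉[] (DegreeBelow-0⇒≈[] r<0))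
    cancel-lowDegree (suc k) r b r<k k≤d r≉[] P∣rb with leading r (suc k) r<k
    ... | zeroPoly r≈[] = ⊥-elim (r≉[] r≈[])
    ... | leadingAt j j≤k ≢0 r<j = lowest j refl
      where
      P∣wb : mon p ∣ₚ (mon (monicPart r j ≢0) ⊛ b)
      P∣wb = ∣ₚ-unscale (mon (monicPart r j ≢0)) ≢0 (∣ₚ-respʳ (⊛-congˡ b (≈-scale-monicPart r j ≢0 r<j)) P∣rb)
      lowest : ∀ j′ → j′ ≡ j → mon p ∣ₚ b
      lowest zero    refl = ∣ₚ-respʳ (⊛-identityˡ b) P∣wb
      lowest (suc _) refl with divideByMonic (monicPart r j ≢0) (mon p)
      ... | s , u , u<j , P≈ws+u with leading u j u<j
      ...   | zeroPoly u≈[] =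
              ⊥-elim (noProperFactor (monicPart r j ≢0) (s≤s z≤n) (ℕₚ.≤-trans j≤k k≤d)
                        (s , ≈-trans P≈ws+u (⊕-≈[]ʳ _ u≈[])))
      ...   | leadingAt _ _ ≢0′ _ =
              cancel-lowDegree k u b (DegreeBelow-mono {u} (ℕₚ.≤-pred j≤k) u<j) (ℕₚ.≤-trans (ℕₚ.n≤1+n k) k≤d)
                (≢0⇒≉[] ≢0′)
                (∣ₚ-remainder s (mon (monicPart r j ≢0)) (∣ₚ-⊛ʳ (mon p) b) P∣wb
                   (≈-trans P≈ws+u (⊕-cong (⊛-comm _ s) ≈-refl)))

    euclid : ∀ a b → mon p ∣ₚ (a ⊛ b) → ¬ (mon p ∣ₚ a) → mon p ∣ₚ b
    euclid a b P∣ab P∤a with divideByMonic p a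
    ... | t , r , r<d , a≈Pt+r with leading r d r<d
    ...   | zeroPoly r≈[] = ⊥-elim (P∤a (t , ≈-trans a≈Pt+r (⊕-≈[]ʳ _ r≈[])))
    ...   | leadingAt _ _ ≢0 _ =
            cancel-lowDegree d r b r<d ℕₚ.≤-refl (≢0⇒≉[] ≢0)
              (∣ₚ-remainder t (mon p) P∣ab (∣ₚ-⊛ʳ (mon p) b) (≈-trans a≈Pt+r (⊕-cong (⊛-comm (mon p) t) ≈-refl)))


module Monic (K : FiniteField) where

  open import Data.Nat as ℕ using (ℕ; suc; _≤_; _∸_; _⊔_)
  import Data.Nat.Properties as ℕₚ
  open import Data.List using ([]; _∷_; [_]; length)
  import Data.List.Properties as Listₚ
  open import Data.Vec using (Vec; []; _∷_)
  open import Data.Product using (Σ; _×_; _,_; proj₂)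
  open import Data.Empty using (⊥-elim)
  open import Relation.Nullary using (¬_)
  open import Relation.Binary.Definitions using (tri<; tri≈; tri>)
  open import Relation.Binary.PropositionalEquality hiding ([_])
  open FiniteField K
  open Poly K
  open PolynomialArithmetic K
  open Degree K
  open Divisibility K

  record IsMonic (X : Pol) (a : ℕ) : Set where
    constructor _,_
    field
      degreeBelow : DegreeBelow X (suc a)
      leading≡1   : coeff X a ≡ 1#

  mon-IsMonic : ∀ {d} (v : Vec F d) → IsMonic (mon v) d
  mon-IsMonic v = mon-DegreeBelow v , coeff-mon-degree v

  IsMonic-resp-≈ : ∀ {X Y a} → X ≈ Y → IsMonic X a → IsMonic Y a
  IsMonic-resp-≈ {X} {Y} p (b , t) = DegreeBelow-resp-≈ {X} {Y} p b , trans (sym (at p _)) t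

  IsMonic-⊛ : ∀ {X Y a b} → IsMonic X a → IsMonic Y b → IsMonic (X ⊛ Y) (a ℕ.+ b)
  IsMonic-⊛ {X} {Y} {a} {b} (bx , tx) (by , ty) with ⊛-DegreeBelow X Y a b bx by
  ... | below , leading = below , trans leading (trans (cong₂ _*_ tx ty) (*-identityʳ 1#))

  1≢0 : 1# ≢ 0#
  1≢0 e = 0≢1 (sym e)

  IsMonic-degree-unique : ∀ {X a b} → IsMonic X a → IsMonic X b → a ≡ b
  IsMonic-degree-unique {X} {a} {b} (ba , ta) (bb , tb) with ℕₚ.<-cmp a b
  ... | tri< lt _ _ = ⊥-elim (1≢0 (trans (sym tb) (ba b lt)))
  ... | tri≈ _ e _  = e
  ... | tri> _ _ gt = ⊥-elim (1≢0 (trans (sym ta) (bb a gt)))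

  IsMonic⇒≉[] : ∀ {X a} → IsMonic X a → ¬ (X ≈ [])
  IsMonic⇒≉[] (b , t) z = 1≢0 (trans (sym t) (at z _))

  mon-tabulate-coeff : ∀ {X a} → IsMonic X a → mon (tabulate a (coeff X)) ≈ X
  mon-tabulate-coeff {X} {a} (b , t) = ⟨ coeff-≡ ⟩
    where
    w = tabulate a (coeff X)
    coeff-≡ : ∀ i → coeff (mon w) i ≡ coeff X i
    coeff-≡ i with ℕₚ.<-cmp i a
    ... | tri< lt _ _   = trans (coeff-++-< w [ 1# ] i lt) (coeff-tabulate a (coeff X) i lt)
    ... | tri≈ _ refl _ = trans (coeff-mon-degree w) (sym t)
    ... | tri> _ _ gt   = trans (mon-DegreeBelow w i gt) (sym (b i gt))

  IsMonic-≈-scale : ∀ {X Y a b c} → IsMonic X a → IsMonic Y b → X ≈ scale c Y → c ≢ 0# → a ≡ b × c ≡ 1#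
  IsMonic-≈-scale {X} {Y} {a} {b} {c} (bx , tx) (by , ty) p ≢0 with ℕₚ.<-cmp a b
  ... | tri< lt _ _ = ⊥-elim (≢0 (trans (sym (*-identityʳ c)) (trans (cong (c *_) (sym ty))
                        (trans (sym (coeff-scale c Y b)) (trans (sym (at p b)) (bx b lt))))))
  ... | tri> _ _ gt = ⊥-elim (1≢0 (trans (sym tx) (trans (at p a)
                        (trans (coeff-scale c Y a) (trans (cong (c *_) (by a gt)) (zeroʳ c))))))
  ... | tri≈ _ refl _ = refl , trans (sym (*-identityʳ c)) (trans (cong (c *_) (sym ty))
                          (trans (sym (coeff-scale c Y a)) (trans (sym (at p a)) tx)))

  IsMonic-⊛-≈[] : ∀ {X a} Z → IsMonic X a → (X ⊛ Z) ≈ [] → Z ≈ []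
  IsMonic-⊛-≈[] {X} {a} Z (bx , tx) z with leading Z (length Z) (DegreeBelow-length Z)
  ... | zeroPoly z≈[] = z≈[]
  ... | leadingAt j _ ≢0 bj = ⊥-elim (≢0 (begin
    coeff Z j            ≡⟨ *-identityˡ _ ⟨
    1# * coeff Z j       ≡⟨ cong (_* coeff Z j) tx ⟨
    coeff X a * coeff Z j ≡⟨ proj₂ (⊛-DegreeBelow X Z a j bx bj) ⟨
    coeff (X ⊛ Z) (a ℕ.+ j) ≡⟨ at z (a ℕ.+ j) ⟩
    0#                   ∎))
    where open ≡-Reasoning

  IsMonic-⊛-cancelˡ : ∀ {X a} Y Z → IsMonic X a → (X ⊛ Y) ≈ (X ⊛ Z) → Y ≈ Z
  IsMonic-⊛-cancelˡ {X} Y Z m p = ⊕-neg-≈[]⇒≈ Y Z (IsMonic-⊛-≈[] (Y ⊕ neg Z) m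
    (≈-trans (⊛-distribˡ Y (neg Z) X) (≈-trans (⊕-cong p (⊛-neg X Z)) (⊕-inverseʳ (X ⊛ Z)))))

  ∣ₚ-cancelˡ : ∀ {X a} Y Z → IsMonic X a → (X ⊛ Y) ∣ₚ (X ⊛ Z) → Y ∣ₚ Z
  ∣ₚ-cancelˡ {X} Y Z m (t , e) = t , IsMonic-⊛-cancelˡ Z (Y ⊛ t) m (≈-trans e (⊛-assoc X Y t))

  IsMonic-∣ₚ-mon : ∀ {A a n} (f : Vec F n) → IsMonic A a → A ∣ₚ mon f →
                   a ≤ n × Σ (Vec F (n ∸ a)) λ h → (A ⊛ mon h) ≈ mon f
  IsMonic-∣ₚ-mon {A} {a} {n} f ma (t , e) with leading t (length t) (DegreeBelow-length t)
  ... | zeroPoly t≈[] = ⊥-elim (IsMonic⇒≉[] (mon-IsMonic f) (≈-trans e (⊛-≈[] A t≈[])))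
  ... | leadingAt j _ ≢0 bj with IsMonic-≈-scale (mon-IsMonic f) (IsMonic-⊛ ma (mon-IsMonic (monicPart t j ≢0)))
                                   (≈-trans e (≈-trans (⊛-congʳ A (≈-scale-monicPart t j ≢0 bj))
                                                       (⊛-scale (coeff t j) A (mon (monicPart t j ≢0))))) ≢0
  ...   | n≡a+j , c≡1 = a≤n , tabulate (n ∸ a) (coeff t) , ≈-trans (⊛-congʳ A (mon-tabulate-coeff t-monic)) (≈-sym e)
    where
    a≤n : a ≤ n
    a≤n = subst (a ≤_) (sym n≡a+j) (ℕₚ.m≤m+n a j)
    t≈w : t ≈ mon (monicPart t j ≢0)
    t≈w = ≈-trans (≈-scale-monicPart t j ≢0 bj) (≈-trans (scale-congˡ _ c≡1) (scale-1 _))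
    t-monic : IsMonic t (n ∸ a)
    t-monic = subst (IsMonic t) (trans (sym (ℕₚ.m+n∸m≡n a j)) (cong (_∸ a) (sym n≡a+j)))
                (IsMonic-resp-≈ (≈-sym t≈w) (mon-IsMonic (monicPart t j ≢0)))

  length-mon : ∀ {d} (v : Vec F d) → length (mon v) ≡ suc d
  length-mon []      = refl
  length-mon (c ∷ v) = cong suc (length-mon v)

  length-⊕ : ∀ f g → length (f ⊕ g) ≡ length f ⊔ length g
  length-⊕ []      g       = refl
  length-⊕ (a ∷ f) []      = sym (ℕₚ.⊔-identityʳ (suc (length f)))
  length-⊕ (a ∷ f) (b ∷ g) = cong suc (length-⊕ f g)

  length-∷-⊛ : ∀ a f b g → length ((a ∷ f) ⊛ (b ∷ g)) ≡ suc (length f ℕ.+ length g)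
  length-∷-⊛ a []      b g = trans (length-⊕ (scale a (b ∷ g)) (0# ∷ []))
                               (cong suc (trans (ℕₚ.⊔-identityʳ _) (Listₚ.length-map (a *_) g)))
  length-∷-⊛ a (c ∷ f) b g = trans (length-⊕ (scale a (b ∷ g)) (0# ∷ ((c ∷ f) ⊛ (b ∷ g))))
    (trans (cong₂ _⊔_ (Listₚ.length-map (a *_) (b ∷ g)) (cong suc (length-∷-⊛ c f b g)))
      (cong suc (ℕₚ.m≤n⇒m⊔n≡n (ℕₚ.≤-trans (ℕₚ.m≤n+m (length g) (length f)) (ℕₚ.n≤1+n _)))))

  length-⊛ : ∀ X Y {x y} → length X ≡ suc x → length Y ≡ suc y → length (X ⊛ Y) ≡ suc (x ℕ.+ y)
  length-⊛ (a ∷ f) (b ∷ g) lx ly =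
    trans (length-∷-⊛ a f b g) (cong suc (cong₂ ℕ._+_ (ℕₚ.suc-injective lx) (ℕₚ.suc-injective ly)))

  ≈∧length≡⇒≡ : ∀ f g → length f ≡ length g → f ≈ g → f ≡ g
  ≈∧length≡⇒≡ []      []      _ _ = refl
  ≈∧length≡⇒≡ (a ∷ f) (b ∷ g) l p =
    cong₂ _∷_ (∷-injectiveˡ p) (≈∧length≡⇒≡ f g (ℕₚ.suc-injective l) (∷-injectiveʳ p))

  ∣⇒∣ₚ : ∀ {d n} {g : Vec F d} {f : Vec F n} → g ∣ f → mon g ∣ₚ mon f
  ∣⇒∣ₚ (_ , h , e) = mon h , ≈-sym (≈-reflexive e)

  ∣ₚ⇒∣ : ∀ {d n} {g : Vec F d} {f : Vec F n} → mon g ∣ₚ mon f → g ∣ f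
  ∣ₚ⇒∣ {d} {n} {g} {f} D with IsMonic-∣ₚ-mon f (mon-IsMonic g) D
  ... | d≤n , h , e = d≤n , h , ≈∧length≡⇒≡ _ _ lengths e
    where
    lengths : length (mon g ⊛ mon h) ≡ length (mon f)
    lengths = trans (length-⊛ (mon g) (mon h) (length-mon g) (length-mon h))
                (trans (cong suc (ℕₚ.m+[n∸m]≡n d≤n)) (sym (length-mon f)))


module SquareFreeness (K : FiniteField) where

  open import Data.Nat as ℕ using (ℕ; suc; _≤_; _<_; s≤s; _∸_; _≤?_)
  import Data.Nat.Properties as ℕₚ
  open import Data.Nat.Induction using (<-rec)
  open import Data.List using ([]; length)
  open import Data.Vec using (Vec; [])
  open import Data.Product using (Σ; _×_; _,_)
  open import Data.Sum using (inj₁; inj₂)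
  open import Data.Empty using (⊥-elim)
  open import Relation.Nullary using (¬_; yes; no; Dec)
  open import Relation.Nullary.Decidable using (_×-dec_; map′)
  open import Relation.Binary.PropositionalEquality hiding ([_])
  open FiniteField K
  open Poly K
  open PolynomialArithmetic K
  open Degree K
  open Divisibility K
  open Monic K

  HasSquareFactor : Pol → Set
  HasSquareFactor B = Σ ℕ λ e → 1 ≤ e × Σ (Vec F e) λ k → (mon k ⊛ mon k) ∣ₚ B

  SquareFreeₚ : Pol → Set
  SquareFreeₚ B = ¬ HasSquareFactor B

  SquareFreeₚ-resp-≈ : ∀ {B B′} → B ≈ B′ → SquareFreeₚ B → SquareFreeₚ B′
  SquareFreeₚ-resp-≈ p s (e , 1≤e , k , D) = s (e , 1≤e , k , ∣ₚ-respʳ (≈-sym p) D)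

  private
    e+e≡2*e : ∀ e → e ℕ.+ e ≡ 2 ℕ.* e
    e+e≡2*e e = cong (e ℕ.+_) (sym (ℕₚ.+-identityʳ e))

  SquareFree⇒SquareFreeₚ : ∀ {n} {f : Vec F n} → SquareFree f → SquareFreeₚ (mon f)
  SquareFree⇒SquareFreeₚ {n} {f} sf (e , 1≤e , k , D)
    with IsMonic-∣ₚ-mon f (subst (IsMonic (mon k ⊛ mon k)) (e+e≡2*e e) (IsMonic-⊛ (mon-IsMonic k) (mon-IsMonic k))) D
  ... | 2e≤n , h , eq = sf (e , 1≤e , k , 2e≤n , h , ≈∧length≡⇒≡ _ _ lengths eq)
    where
    lengths : length ((mon k ⊛ mon k) ⊛ mon h) ≡ length (mon f)
    lengths = trans (length-⊛ (mon k ⊛ mon k) (mon h) (length-⊛ (mon k) (mon k) (length-mon k) (length-mon k)) (length-mon h))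
                (trans (cong suc (trans (cong (ℕ._+ (n ∸ 2 ℕ.* e)) (e+e≡2*e e)) (ℕₚ.m+[n∸m]≡n 2e≤n)))
                       (sym (length-mon f)))

  SquareFreeₚ⇒SquareFree : ∀ {n} {f : Vec F n} → SquareFreeₚ (mon f) → SquareFree f
  SquareFreeₚ⇒SquareFree s (e , 1≤e , k , _ , h , eq) = s (e , 1≤e , k , mon h , ≈-sym (≈-reflexive eq))

  squareDivisor? : ∀ {n} (f : Vec F n) → Dec (SquareDivisor f)
  squareDivisor? {n} f = map′ (λ (e , _ , p) → e , p) (λ (e , p) → e , e<1+n p , p) (ℕₚ.anyUpTo? divisor? (suc n))
    where
    SquareDivisorOfDegree : ℕ → Set
    SquareDivisorOfDegree e = 1 ≤ e × Σ (Vec F e) λ g →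
      (2 ℕ.* e ≤ n × Σ (Vec F (n ∸ 2 ℕ.* e)) λ h → (mon g ⊛ mon g) ⊛ mon h ≡ mon f)
    divisor? : ∀ e → Dec (SquareDivisorOfDegree e)
    divisor? e = (1 ≤? e) ×-dec ∃Vec? e (λ g → (2 ℕ.* e ≤? n) ×-dec
                   ∃Vec? (n ∸ 2 ℕ.* e) (λ h → polDec ((mon g ⊛ mon g) ⊛ mon h) (mon f)))
    e<1+n : ∀ {e} → SquareDivisorOfDegree e → e < suc n
    e<1+n {e} (_ , _ , 2e≤n , _) = s≤s (ℕₚ.≤-trans (ℕₚ.m≤m+n e (e ℕ.+ 0)) 2e≤n)

  nontrivialDivisor? : ∀ {d} (g : Vec F d) → Dec (NontrivialDivisor g)
  nontrivialDivisor? {d} g = ℕₚ.anyUpTo? (λ e → (1 ≤? e) ×-dec ∃Vec? e (λ h → h ∣? g)) d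

  Irreducible⇒noProperFactor : ∀ {d} {g : Vec F d} → Irreducible g →
                               ∀ {j} (w : Vec F j) → 1 ≤ j → j < d → ¬ (mon w ∣ₚ mon g)
  Irreducible⇒noProperFactor (_ , no-divisor) w 1≤j j<d w∣g = no-divisor (_ , j<d , 1≤j , w , ∣ₚ⇒∣ w∣g)

  irreducible-euclid : ∀ {d} {p : Vec F d} → Irreducible p →
                       ∀ a b → mon p ∣ₚ (a ⊛ b) → ¬ (mon p ∣ₚ a) → mon p ∣ₚ b
  irreducible-euclid {p = p} irr = EuclidsLemma.euclid p (Irreducible⇒noProperFactor irr)

  irreducible-square-euclid : ∀ {d} {p : Vec F d} → Irreducible p →
                              ∀ X Y → (mon p ⊛ mon p) ∣ₚ (X ⊛ Y) → ¬ (mon p ∣ₚ X) → (mon p ⊛ mon p) ∣ₚ Y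
  irreducible-square-euclid {p = p} irr X Y p²∣XY p∤X
    with irreducible-euclid irr X Y (∣ₚ-trans (∣ₚ-⊛ʳ (mon p) (mon p)) p²∣XY) p∤X
  ... | Y₁ , Y≈pY₁ = ∣ₚ-respʳ (≈-sym Y≈pY₁) (∣ₚ-respˡ (⊛-comm (mon p) (mon p)) (∣ₚ-⊛-⊛ (∣ₚ-refl (mon p)) p∣Y₁))
    where
    p∣XY₁ : mon p ∣ₚ (X ⊛ Y₁)
    p∣XY₁ = ∣ₚ-cancelˡ (mon p) (X ⊛ Y₁) (mon-IsMonic p)
              (∣ₚ-respʳ (≈-trans (⊛-congʳ X Y≈pY₁) (⊛.x∙yz≈y∙xz X (mon p) Y₁)) p²∣XY)
    p∣Y₁ : mon p ∣ₚ Y₁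
    p∣Y₁ = irreducible-euclid irr X Y₁ p∣XY₁ p∤X

  irreducibleFactor : ∀ {e} (k : Vec F e) → 1 ≤ e →
                      Σ ℕ λ d → Σ (Vec F d) λ p → Irreducible p × mon p ∣ₚ mon k
  irreducibleFactor {e} = <-rec Goal factor e
    where
    Goal : ℕ → Set
    Goal e = (k : Vec F e) → 1 ≤ e → Σ ℕ λ d → Σ (Vec F d) λ p → Irreducible p × mon p ∣ₚ mon k
    factor : ∀ e → (∀ {e′} → e′ < e → Goal e′) → Goal e
    factor e rec k 1≤e with nontrivialDivisor? k
    ... | no none = e , k , (1≤e , none) , ∣ₚ-refl (mon k)
    ... | yes (e′ , e′<e , 1≤e′ , h , h∣k) with rec e′<e h 1≤e′
    ...   | d , p , irr , p∣h = d , p , irr , ∣ₚ-trans p∣h (∣⇒∣ₚ h∣k)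

  irreducible-∣-irreducible : ∀ {d e} {p : Vec F e} {g : Vec F d} →
                              Irreducible p → Irreducible g → p ∣ g → mon p ≈ mon g
  irreducible-∣-irreducible {d} {e} {p} {g} (1≤e , _) (_ , no-divisor) (e≤d , h , eq) with ℕₚ.m≤n⇒m<n∨m≡n e≤d
  ... | inj₁ e<d  = ⊥-elim (no-divisor (e , e<d , 1≤e , p , e≤d , h , eq))
  ... | inj₂ refl = unit-cofactor h eq
    where
    unit-cofactor : (h : Vec F (e ∸ e)) → (mon p ⊛ mon h) ≡ mon g → mon p ≈ mon g
    unit-cofactor h eq with e ∸ e | ℕₚ.n∸n≡0 e
    unit-cofactor [] eq | .0 | refl = ≈-trans (≈-sym (⊛-identityʳ (mon p))) (≈-reflexive eq)


module SquareDecomposition (K : FiniteField) where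

  open import Data.Nat as ℕ using (ℕ; zero; suc; _≤_; _<_; z≤n; s≤s; _∸_)
  import Data.Nat.Properties as ℕₚ
  open import Data.Nat.Induction using (<-rec)
  open import Data.List using ([]; _∷_)
  open import Data.Vec using (Vec; []; _∷_)
  open import Data.Product using (_,_; proj₁)
  open import Data.Empty using (⊥-elim)
  open import Relation.Nullary using (¬_; yes; no)
  open import Relation.Binary.PropositionalEquality hiding ([_])
  open FiniteField K
  open Poly K
  open PolynomialArithmetic K
  open Degree K
  open Divisibility K
  open Monic K
  open SquareFreeness K

  -- A square factor k² of g h has an irreducible factor p, and p² divides g h; either p = g and
  -- then g ∣ h, or p ∤ g and then p² ∣ h.
  SquareFreeₚ-⊛-irreducible : ∀ {d m} {g : Vec F d} {h : Vec F m} → Irreducible g → SquareFreeₚ (mon h) →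
                              ¬ (mon g ∣ₚ mon h) → SquareFreeₚ (mon g ⊛ mon h)
  SquareFreeₚ-⊛-irreducible {g = g} {h} irr-g sf-h g∤h (e , 1≤e , k , k²∣gh) with irreducibleFactor k 1≤e
  ... | _ , p , irr-p , p∣k with p ∣? g
  ...   | yes p∣g = g∤h (∣ₚ-cancelˡ (mon g) (mon h) (mon-IsMonic g)
                      (∣ₚ-trans (∣ₚ-respˡ (⊛-cong p≈g p≈g) (∣ₚ-⊛-⊛ p∣k p∣k)) k²∣gh))
    where p≈g = irreducible-∣-irreducible irr-p irr-g p∣g
  ...   | no p∤g = sf-h (_ , proj₁ irr-p , p ,
                     irreducible-square-euclid irr-p (mon g) (mon h) (∣ₚ-trans (∣ₚ-⊛-⊛ p∣k p∣k) k²∣gh) (λ x → p∤g (∣ₚ⇒∣ x)))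

  SquareFreeₚ-factor : ∀ {G H F′} → SquareFreeₚ F′ → F′ ≈ (G ⊛ H) → SquareFreeₚ H
  SquareFreeₚ-factor {G} {H} s e (e′ , 1≤e′ , k , D) =
    s (e′ , 1≤e′ , k , ∣ₚ-respʳ (≈-trans (⊛-comm H G) (≈-sym e)) (∣ₚ-⊛ G D))

  SquareFreeₚ⇒∤cofactor : ∀ {d} {g : Vec F d} {H F′} → 1 ≤ d → SquareFreeₚ F′ → F′ ≈ (mon g ⊛ H) → ¬ (mon g ∣ₚ H)
  SquareFreeₚ⇒∤cofactor {g = g} 1≤d s e g∣H = s (_ , 1≤d , g , ∣ₚ-respʳ (≈-sym e) (∣ₚ-⊛-⊛ (∣ₚ-refl (mon g)) g∣H))

  record SquareDecomposition (X : Pol) : Set where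
    constructor decomposition
    field
      {k j}           : ℕ
      root            : Vec F k
      part            : Vec F j
      part-SquareFree : SquareFreeₚ (mon part)
      ≈root²*part     : X ≈ ((mon root ⊛ mon root) ⊛ mon part)

  opaque
    squareDecomposition : ∀ {n} (f : Vec F n) → SquareDecomposition (mon f)
    squareDecomposition {n} = <-rec (λ n → (f : Vec F n) → SquareDecomposition (mon f)) split n
      where
      split : ∀ n → (∀ {m} → m < n → (f : Vec F m) → SquareDecomposition (mon f)) → (f : Vec F n) → SquareDecomposition (mon f)
      split n rec f with squareDivisor? f
      ... | no none = decomposition [] f (SquareFree⇒SquareFreeₚ none)
                        (≈-sym (≈-trans (⊛-congˡ (mon f) (⊛-identityˡ (1# ∷ []))) (⊛-identityˡ (mon f))))
      ... | yes (e , 1≤e , k , 2e≤n , h , f≡k²h)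
        with rec (ℕₚ.∸-monoʳ-< {o = 0} (ℕₚ.≤-trans 1≤e (ℕₚ.m≤m+n e _)) 2e≤n) h
      ...   | decomposition {k′} a b sf-b h≈a²b = decomposition c b sf-b f≈c²b
        where
        c : Vec F (e ℕ.+ k′)
        c = tabulate (e ℕ.+ k′) (coeff (mon k ⊛ mon a))
        c≈ka : mon c ≈ (mon k ⊛ mon a)
        c≈ka = mon-tabulate-coeff (IsMonic-⊛ (mon-IsMonic k) (mon-IsMonic a))
        f≈c²b : mon f ≈ ((mon c ⊛ mon c) ⊛ mon b)
        f≈c²b = ≈-trans (≈-sym (≈-reflexive f≡k²h))
                (≈-trans (⊛-congʳ (mon k ⊛ mon k) h≈a²b)
                (≈-trans (≈-sym (⊛-assoc (mon k ⊛ mon k) (mon a ⊛ mon a) (mon b)))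
                (⊛-congˡ (mon b) (≈-trans (⊛.interchange (mon k) (mon k) (mon a) (mon a)) (≈-sym (⊛-cong c≈ka c≈ka))))))

  -- Compare an irreducible factor p of a with a′: p ∤ a′ would make p² divide the square-free b′,
  -- so p divides both roots and can be cancelled.
  squareDecomposition-unique :
    ∀ {k k′ j j′} (a : Vec F k) (a′ : Vec F k′) (b : Vec F j) (b′ : Vec F j′) →
    SquareFreeₚ (mon b) → SquareFreeₚ (mon b′) →
    ((mon a ⊛ mon a) ⊛ mon b) ≈ ((mon a′ ⊛ mon a′) ⊛ mon b′) → mon a ≈ mon a′
  squareDecomposition-unique {k} = <-rec Goal cancelRoots k
    where
    Goal : ℕ → Set
    Goal k = ∀ {k′ j j′} (a : Vec F k) (a′ : Vec F k′) (b : Vec F j) (b′ : Vec F j′) →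
             SquareFreeₚ (mon b) → SquareFreeₚ (mon b′) →
             ((mon a ⊛ mon a) ⊛ mon b) ≈ ((mon a′ ⊛ mon a′) ⊛ mon b′) → mon a ≈ mon a′
    a²b≈ : ∀ B P H → (((P ⊛ H) ⊛ (P ⊛ H)) ⊛ B) ≈ (P ⊛ (P ⊛ ((H ⊛ H) ⊛ B)))
    a²b≈ B P H = ≈-trans (⊛-congˡ B (⊛.interchange P H P H))
                     (≈-trans (⊛-assoc (P ⊛ P) (H ⊛ H) B) (⊛-assoc P P ((H ⊛ H) ⊛ B)))
    cancelRoots : ∀ k → (∀ {k₀} → k₀ < k → Goal k₀) → Goal k
    cancelRoots zero rec {zero} [] [] b b′ _ _ _ = ≈-refl
    cancelRoots zero rec {suc _} [] a′ b b′ sf-b _ e =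
      ⊥-elim (sf-b (_ , s≤s z≤n , a′ , ∣ₚ-respʳ (≈-trans (≈-sym e) b≈1²b) (∣ₚ-⊛ʳ (mon a′ ⊛ mon a′) (mon b′))))
      where b≈1²b = ≈-trans (⊛-congˡ (mon b) (⊛-identityˡ (1# ∷ []))) (⊛-identityˡ (mon b))
    cancelRoots (suc k₀) rec a a′ b b′ sf-b sf-b′ e with irreducibleFactor a (s≤s z≤n)
    ... | dp , p , irr-p , p∣a with p ∣? a′
    ...   | no p∤a′ = ⊥-elim (sf-b′ (dp , proj₁ irr-p , p ,
                        irreducible-square-euclid irr-p (mon a′) (mon b′) p²∣a′b′ p∤ₚa′))
      where
      p∤ₚa′ : ¬ (mon p ∣ₚ mon a′)
      p∤ₚa′ x = p∤a′ (∣ₚ⇒∣ x)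
      p²∣a′b′ : (mon p ⊛ mon p) ∣ₚ (mon a′ ⊛ mon b′)
      p²∣a′b′ = irreducible-square-euclid irr-p (mon a′) (mon a′ ⊛ mon b′)
                  (∣ₚ-respʳ (⊛-assoc (mon a′) (mon a′) (mon b′))
                    (∣ₚ-respʳ e (∣ₚ-trans (∣ₚ-⊛-⊛ p∣a p∣a) (∣ₚ-⊛ʳ (mon a ⊛ mon a) (mon b)))))
                  p∤ₚa′
    ...   | yes p∣a′ with IsMonic-∣ₚ-mon a (mon-IsMonic p) p∣a | IsMonic-∣ₚ-mon a′ (mon-IsMonic p) (∣⇒∣ₚ p∣a′)
    ...     | _ , h , ph≈a | _ , h′ , ph′≈a′ =
              ≈-trans (≈-sym ph≈a) (≈-trans (⊛-congʳ (mon p) (rec smaller h h′ b b′ sf-b sf-b′ cancelled)) ph′≈a′)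
      where
      smaller : suc k₀ ∸ dp < suc k₀
      smaller = s≤s (ℕₚ.∸-monoʳ-≤ (suc k₀) (proj₁ irr-p))
      cancelled : ((mon h ⊛ mon h) ⊛ mon b) ≈ ((mon h′ ⊛ mon h′) ⊛ mon b′)
      cancelled = IsMonic-⊛-cancelˡ _ _ (mon-IsMonic p) (IsMonic-⊛-cancelˡ _ _ (mon-IsMonic p)
        (≈-trans (≈-sym (a²b≈ (mon b) (mon p) (mon h)))
        (≈-trans (⊛-congˡ (mon b) (⊛-cong ph≈a ph≈a))
        (≈-trans e
        (≈-trans (⊛-congˡ (mon b′) (⊛-cong (≈-sym ph′≈a′) (≈-sym ph′≈a′))) (a²b≈ (mon b′) (mon p) (mon h′)))))))


module Counting where

  open import Data.Nat as ℕ using (ℕ; suc; _≤_; z≤n; s≤s; _+_)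
  import Data.Nat.Properties as ℕₚ
  open import Data.List using (List; []; _∷_; _++_; length; filter)
  import Data.List.Properties as Listₚ
  open import Data.List.Membership.Propositional using (_∈_)
  open import Data.List.Membership.Propositional.Properties using (∈-∃++; ∈-filter⁺; ∈-filter⁻)
  open import Data.List.Relation.Unary.Any using (here; there)
  open import Data.List.Relation.Unary.All as All using (lookup)
  open import Data.List.Relation.Unary.Unique.Propositional using (Unique)
  import Data.List.Relation.Unary.Unique.Propositional.Properties as Uniqueₚ
  open import Data.List.Relation.Unary.AllPairs using (_∷_)
  open import Data.Product using (_,_; proj₂)
  open import Data.Empty using (⊥-elim)
  open import Relation.Nullary using (¬_; yes; no)
  open import Relation.Unary using (Decidable)
  open import Relation.Nullary.Decidable using (_×-dec_; ¬?)
  open import Relation.Binary.PropositionalEquality hiding ([_])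

  count : ∀ {A : Set} {P : A → Set} → Decidable P → List A → ℕ
  count P? xs = length (filter P? xs)

  private
    ∈-++-remove : ∀ {B : Set} {y x : B} xs₁ xs₂ → y ∈ (xs₁ ++ x ∷ xs₂) → y ≢ x → y ∈ (xs₁ ++ xs₂)
    ∈-++-remove []        xs₂ (here refl) y≢x = ⊥-elim (y≢x refl)
    ∈-++-remove []        xs₂ (there p)   y≢x = p
    ∈-++-remove (z ∷ xs₁) xs₂ (here refl) y≢x = here refl
    ∈-++-remove (z ∷ xs₁) xs₂ (there p)   y≢x = there (∈-++-remove xs₁ xs₂ p y≢x)

  length-≤-injection : ∀ {A B : Set} (us : List A) (vs : List B) (f : A → B) → Unique us →
                       (∀ {u} → u ∈ us → f u ∈ vs) →
                       (∀ {u u′} → u ∈ us → u′ ∈ us → f u ≡ f u′ → u ≡ u′) → length us ≤ length vs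
  length-≤-injection []       vs f _          _   _   = z≤n
  length-≤-injection (u ∷ us) vs f (u∉ ∷ uniq) ∈vs inj with ∈-∃++ (∈vs (here refl))
  ... | vs₁ , vs₂ , refl =
    ℕₚ.≤-trans (s≤s (length-≤-injection us (vs₁ ++ vs₂) f uniq ∈vs′ (λ p q → inj (there p) (there q))))
      (ℕₚ.≤-reflexive (sym (trans (Listₚ.length-++ vs₁)
        (trans (ℕₚ.+-suc (length vs₁) (length vs₂)) (cong suc (sym (Listₚ.length-++ vs₁)))))))
    where
    ∈vs′ : ∀ {u′} → u′ ∈ us → f u′ ∈ (vs₁ ++ vs₂)
    ∈vs′ p = ∈-++-remove vs₁ vs₂ (∈vs (there p)) (λ e → lookup u∉ p (inj (here refl) (there p) (sym e)))

  module _ {A B : Set} {P : A → Set} {Q : B → Set} (P? : Decidable P) (Q? : Decidable Q)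
           {xs : List A} {ys : List B} (uniq-xs : Unique xs) (uniq-ys : Unique ys)
           (∈xs : ∀ x → x ∈ xs) (∈ys : ∀ y → y ∈ ys)
           (φ : A → B) (ψ : B → A)
           (φ-P⇒Q : ∀ x → P x → Q (φ x)) (ψ-Q⇒P : ∀ y → Q y → P (ψ y))
           (ψφ : ∀ x → P x → ψ (φ x) ≡ x) (φψ : ∀ y → Q y → φ (ψ y) ≡ y) where

    count-bijection : count P? xs ≡ count Q? ys
    count-bijection = ℕₚ.≤-antisym
      (length-≤-injection (filter P? xs) (filter Q? ys) φ (Uniqueₚ.filter⁺ P? uniq-xs)
        (λ {u} p → ∈-filter⁺ Q? (∈ys (φ u)) (φ-P⇒Q u (P-of p)))
        (λ {u} {u′} p p′ e → trans (sym (ψφ u (P-of p))) (trans (cong ψ e) (ψφ u′ (P-of p′)))))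
      (length-≤-injection (filter Q? ys) (filter P? xs) ψ (Uniqueₚ.filter⁺ Q? uniq-ys)
        (λ {u} p → ∈-filter⁺ P? (∈xs (ψ u)) (ψ-Q⇒P u (Q-of p)))
        (λ {u} {u′} p p′ e → trans (sym (φψ u (Q-of p))) (trans (cong φ e) (φψ u′ (Q-of p′)))))
      where
      P-of : ∀ {u} → u ∈ filter P? xs → P u
      P-of p = proj₂ (∈-filter⁻ P? {xs = xs} p)
      Q-of : ∀ {u} → u ∈ filter Q? ys → Q u
      Q-of p = proj₂ (∈-filter⁻ Q? {xs = ys} p)

  module _ {A : Set} {P : A → Set} (P? : Decidable P) where

    count-none : ∀ xs → (∀ x → ¬ P x) → count P? xs ≡ 0
    count-none xs none = cong length (Listₚ.filter-none P? (All.universal none xs))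

    count-all : ∀ xs → (∀ x → P x) → count P? xs ≡ length xs
    count-all xs all = cong length (Listₚ.filter-all P? (All.universal all xs))

    count-complement : ∀ xs → count P? xs + count (λ x → ¬? (P? x)) xs ≡ length xs
    count-complement []       = refl
    count-complement (x ∷ xs) with P? x
    ... | yes _ = cong suc (count-complement xs)
    ... | no  _ = trans (ℕₚ.+-suc _ _) (cong suc (count-complement xs))

    module _ {Q : A → Set} (Q? : Decidable Q) where

      count-cong : ∀ xs → (∀ x → P x → Q x) → (∀ x → Q x → P x) → count P? xs ≡ count Q? xs
      count-cong xs P⇒Q Q⇒P = cong length (Listₚ.filter-≐ P? Q? (P⇒Q _ , Q⇒P _) xs)

      count-split : ∀ xs → count P? xs ≡ count (λ x → P? x ×-dec Q? x) xs + count (λ x → P? x ×-dec ¬? (Q? x)) xs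
      count-split []       = refl
      count-split (x ∷ xs) with P? x | Q? x
      ... | yes _ | yes _ = cong suc (count-split xs)
      ... | yes _ | no  _ = trans (cong suc (count-split xs)) (sym (ℕₚ.+-suc _ _))
      ... | no  _ | _     = count-split xs

      count-filter : ∀ xs → count Q? (filter P? xs) ≡ count (λ x → P? x ×-dec Q? x) xs
      count-filter []       = refl
      count-filter (x ∷ xs) with P? x
      ... | no  _ = count-filter xs
      ... | yes _ with Q? x
      ...   | yes _ = cong suc (count-filter xs)
      ...   | no  _ = count-filter xs


module Sums where

  open import Data.Nat as ℕ using (ℕ; suc; _+_; _*_)
  import Data.Nat.Properties as ℕₚ
  open import Data.Nat.Solver using (module +-*-Solver)
  open +-*-Solver using (solve; _:=_; _:+_)
  open import Data.Nat.ListAction using (sum)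
  open import Data.List using (List; []; _∷_; map; length; filter)
  open import Data.List.Membership.Propositional using (_∈_)
  open import Data.List.Relation.Unary.Any using (here; there)
  open import Data.Product using (_,_; proj₁; proj₂)
  open import Relation.Nullary using (yes; no; Dec)
  open import Relation.Unary using (Decidable)
  open import Relation.Nullary.Decidable using (_×-dec_)
  open import Relation.Binary.PropositionalEquality hiding ([_])
  open Counting

  sum-cong : ∀ {A : Set} {f g : A → ℕ} ys → (∀ y → y ∈ ys → f y ≡ g y) → sum (map f ys) ≡ sum (map g ys)
  sum-cong []       h = refl
  sum-cong (y ∷ ys) h = cong₂ _+_ (h y (here refl)) (sum-cong ys (λ y′ m → h y′ (there m)))

  sum-const : ∀ {A : Set} c (ys : List A) → sum (map (λ _ → c) ys) ≡ length ys * c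
  sum-const c []       = refl
  sum-const c (y ∷ ys) = cong (c +_) (sum-const c ys)

  sum-*ˡ : ∀ {A : Set} a (f : A → ℕ) ys → sum (map (λ y → a * f y) ys) ≡ a * sum (map f ys)
  sum-*ˡ a f []       = sym (ℕₚ.*-zeroʳ a)
  sum-*ˡ a f (y ∷ ys) = trans (cong (a * f y +_) (sum-*ˡ a f ys)) (sym (ℕₚ.*-distribˡ-+ a (f y) (sum (map f ys))))

  sum-+ : ∀ {A : Set} (f g : A → ℕ) ys → sum (map (λ y → f y + g y) ys) ≡ sum (map f ys) + sum (map g ys)
  sum-+ f g []       = refl
  sum-+ f g (y ∷ ys) =
    trans (cong (f y + g y +_) (sum-+ f g ys))
          (solve 4 (λ a b c d → (a :+ b) :+ (c :+ d) := (a :+ c) :+ (b :+ d)) refl (f y) (g y) (sum (map f ys)) (sum (map g ys)))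

  sum-comm : ∀ {A B : Set} (c : A → B → ℕ) (xs : List A) (ys : List B) →
             sum (map (λ y → sum (map (λ x → c x y) xs)) ys) ≡ sum (map (λ x → sum (map (λ y → c x y) ys)) xs)
  sum-comm c []       ys = trans (sum-const 0 ys) (ℕₚ.*-zeroʳ (length ys))
  sum-comm c (x ∷ xs) ys = trans (sum-+ (λ y → c x y) (λ y → sum (map (λ x → c x y) xs)) ys)
                                 (cong (sum (map (λ y → c x y) ys) +_) (sum-comm c xs ys))

  indicator : ∀ {P : Set} → Dec P → ℕ
  indicator (yes _) = 1
  indicator (no _)  = 0

  count≡sum-indicator : ∀ {A : Set} {P : A → Set} (P? : Decidable P) xs → count P? xs ≡ sum (map (λ x → indicator (P? x)) xs)
  count≡sum-indicator P? []       = refl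
  count≡sum-indicator P? (x ∷ xs) with P? x
  ... | yes _ = cong suc (count≡sum-indicator P? xs)
  ... | no _  = count≡sum-indicator P? xs

  sum-count-comm : ∀ {A B : Set} {R : A → B → Set} (R? : ∀ x y → Dec (R x y)) (xs : List A) (ys : List B) →
                   sum (map (λ y → count (λ x → R? x y) xs) ys) ≡ sum (map (λ x → count (λ y → R? x y) ys) xs)
  sum-count-comm R? xs ys =
    trans (sum-cong ys (λ y _ → count≡sum-indicator (λ x → R? x y) xs))
    (trans (sum-comm (λ x y → indicator (R? x y)) xs ys)
    (sum-cong xs (λ x _ → sym (count≡sum-indicator (λ y → R? x y) ys))))

  sum-count-filter : ∀ {A B : Set} {I : A → Set} (I? : Decidable I) {R : A → B → Set} (R? : ∀ x y → Dec (R x y)) xs ys →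
    sum (map (λ x → count (λ y → I? x ×-dec R? x y) ys) xs) ≡ sum (map (λ x → count (R? x) ys) (filter I? xs))
  sum-count-filter I? R? []       ys = refl
  sum-count-filter I? R? (x ∷ xs) ys with I? x
  ... | yes ix = cong₂ _+_ (count-cong (λ y → yes ix ×-dec R? x y) (R? x) ys (λ _ p → proj₂ p) (λ _ p → ix , p))
                           (sum-count-filter I? R? xs ys)
  ... | no ¬ix = trans (cong (_+ _) (count-none (λ y → no ¬ix ×-dec R? x y) ys (λ y p → ¬ix (proj₁ p))))
                       (sum-count-filter I? R? xs ys)


module MonicEnumeration (K : FiniteField) where

  open import Data.Nat as ℕ using (ℕ; zero; suc; _≤_; _^_)
  open import Data.List using (List; []; _∷_; map; length; concatMap)
  import Data.List.Properties as Listₚ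
  open import Data.List.Membership.Propositional using (_∈_)
  open import Data.List.Membership.Propositional.Properties using (∈-map⁺; ∈-map⁻; ∈-++⁺ˡ; ∈-++⁺ʳ; ∈-++⁻)
  open import Data.List.Relation.Unary.Any using (here; there)
  open import Data.List.Relation.Unary.All using (lookup; []; _∷_)
  open import Data.List.Relation.Unary.Unique.Propositional using (Unique)
  import Data.List.Relation.Unary.Unique.Propositional.Properties as Uniqueₚ
  open import Data.List.Relation.Unary.AllPairs using ([]; _∷_)
  open import Data.Vec using (Vec; []; _∷_; head)
  open import Data.Product using (_×_; _,_)
  open import Data.Sum using (inj₁; inj₂)
  open import Data.Empty using (⊥)
  open import Relation.Binary.PropositionalEquality hiding ([_])
  open FiniteField K
  open Poly K
  open Counting using (length-≤-injection)

  q : ℕ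
  q = order

  2≤q : 2 ≤ q
  2≤q = length-≤-injection (0# ∷ 1# ∷ []) elements (λ x → x) ((0≢1 ∷ []) ∷ [] ∷ []) (λ {u} _ → complete u) (λ _ _ e → e)

  private
    prepend : ∀ {d} → List F → List (Vec F d) → List (Vec F (suc d))
    prepend es L = concatMap (λ a → map (a ∷_) L) es

    ∈-prepend : ∀ {d} {a} {v : Vec F d} es L → a ∈ es → v ∈ L → (a ∷ v) ∈ prepend es L
    ∈-prepend (b ∷ es) L (here refl) q = ∈-++⁺ˡ (∈-map⁺ (_ ∷_) q)
    ∈-prepend (b ∷ es) L (there p)   q = ∈-++⁺ʳ (map (b ∷_) L) (∈-prepend es L p q)

    head-∈-prepend : ∀ {d} {v : Vec F (suc d)} es L → v ∈ prepend es L → head v ∈ es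
    head-∈-prepend (b ∷ es) L p with ∈-++⁻ (map (b ∷_) L) p
    ... | inj₂ p′ = there (head-∈-prepend es L p′)
    ... | inj₁ p′ with ∈-map⁻ (b ∷_) p′
    ...   | _ , _ , refl = here refl

    ∷-injectiveʳ : ∀ {d} {a} {v w : Vec F d} → (a ∷ v) ≡ (a ∷ w) → v ≡ w
    ∷-injectiveʳ refl = refl

    prepend-unique : ∀ {d} es (L : List (Vec F d)) → Unique es → Unique L → Unique (prepend es L)
    prepend-unique []       L _            _      = []
    prepend-unique (a ∷ es) L (a∉ ∷ uniq) uniq-L =
      Uniqueₚ.++⁺ (Uniqueₚ.map⁺ ∷-injectiveʳ uniq-L) (prepend-unique es L uniq uniq-L) disjoint
      where
      disjoint : ∀ {v} → (v ∈ map (a ∷_) L) × (v ∈ prepend es L) → ⊥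
      disjoint (p , p′) with ∈-map⁻ (a ∷_) p
      ... | _ , _ , refl = lookup a∉ (head-∈-prepend es L p′) refl

    length-prepend : ∀ {d} es (L : List (Vec F d)) → length (prepend es L) ≡ length es ℕ.* length L
    length-prepend []       L = refl
    length-prepend (a ∷ es) L = trans (Listₚ.length-++ (map (a ∷_) L)) (cong₂ ℕ._+_ (Listₚ.length-map (a ∷_) L) (length-prepend es L))

  allMonic-complete : ∀ d (v : Vec F d) → v ∈ allMonic d
  allMonic-complete zero    []      = here refl
  allMonic-complete (suc d) (a ∷ v) = ∈-prepend elements (allMonic d) (complete a) (allMonic-complete d v)

  allMonic-unique : ∀ d → Unique (allMonic d)
  allMonic-unique zero    = [] ∷ []
  allMonic-unique (suc d) = prepend-unique elements (allMonic d) unique (allMonic-unique d)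

  length-allMonic : ∀ d → length (allMonic d) ≡ q ^ d
  length-allMonic zero    = refl
  length-allMonic (suc d) = trans (length-prepend elements (allMonic d)) (cong (q ℕ.*_) (length-allMonic d))


module SquareFreeCount (K : FiniteField) where

  open import Data.Nat as ℕ using (ℕ; zero; suc; _≤_; z≤n; s≤s; _^_)
  import Data.Nat.Properties as ℕₚ
  open import Data.List using ([]; _∷_; length)
  open import Data.Vec using (Vec; []; _∷_)
  open import Data.Product using (_,_)
  open import Data.Unit using (tt)
  open import Data.Empty using (⊥-elim)
  open import Relation.Nullary using (¬_; yes)
  open import Relation.Nullary.Decidable using (¬?)
  open import Relation.Binary.PropositionalEquality hiding ([_])
  open FiniteField K
  open Poly K
  open PolynomialArithmetic K
  open Degree K
  open Divisibility K
  open Monic K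
  open SquareFreeness K
  open SquareDecomposition K
  open Counting
  open MonicEnumeration K

  #P : ℕ → ℕ
  #P m = length (P m)

  SquareFree-degree≤1 : ∀ {n} (f : Vec F n) → n ≤ 1 → SquareFree f
  SquareFree-degree≤1 f n≤1 (e , 1≤e , _ , 2e≤n , _) =
    ℕₚ.<-irrefl refl (ℕₚ.≤-trans (ℕₚ.*-monoʳ-≤ 2 1≤e) (ℕₚ.≤-trans 2e≤n n≤1))

  #P-degree≤1 : ∀ n → n ≤ 1 → #P n ≡ q ^ n
  #P-degree≤1 n n≤1 = trans (count-all squareFree? (allMonic n) (λ f → SquareFree-degree≤1 f n≤1)) (length-allMonic n)

  a²b-IsMonic : ∀ {k j} (a : Vec F k) (b : Vec F j) → IsMonic ((mon a ⊛ mon a) ⊛ mon b) ((k ℕ.+ k) ℕ.+ j)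
  a²b-IsMonic a b = IsMonic-⊛ (IsMonic-⊛ (mon-IsMonic a) (mon-IsMonic a)) (mon-IsMonic b)

  SquareDecomposition-degree : ∀ {n} {f : Vec F n} (D : SquareDecomposition (mon f)) →
                               n ≡ (SquareDecomposition.k D ℕ.+ SquareDecomposition.k D) ℕ.+ SquareDecomposition.j D
  SquareDecomposition-degree {f = f} (decomposition a b _ f≈a²b) =
    IsMonic-degree-unique (mon-IsMonic f) (IsMonic-resp-≈ (≈-sym f≈a²b) (a²b-IsMonic a b))

  private
    +-suc-suc : ∀ k j → (suc k ℕ.+ suc k) ℕ.+ j ≡ suc (suc ((k ℕ.+ k) ℕ.+ j))
    +-suc-suc k j = cong (λ x → suc x ℕ.+ j) (ℕₚ.+-suc k k)

  -- A non-square-free f = a² b of degree m + 2 has deg a ≥ 1; writing a = c + x a₀, the map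
  -- f ↦ (c , a₀² b) is a bijection onto F × (monic of degree m), because a and b are determined by f.
  -- (split′ returns a junk value when deg a = 0.)
  module NonSquareFree (m : ℕ) where

    split′ : ∀ {X} → SquareDecomposition X → Vec F (suc m)
    split′ (decomposition {zero}  a        b _ _) = tabulate (suc m) (λ _ → 0#)
    split′ (decomposition {suc k} (c ∷ a₀) b _ _) = c ∷ tabulate m (coeff ((mon a₀ ⊛ mon a₀) ⊛ mon b))

    split : Vec F (suc (suc m)) → Vec F (suc m)
    split f = split′ (squareDecomposition f)

    join′ : F → ∀ {X} → SquareDecomposition X → Vec F (suc (suc m))
    join′ c (decomposition a b _ _) = tabulate (suc (suc m)) (coeff ((mon (c ∷ a) ⊛ mon (c ∷ a)) ⊛ mon b))

    join : Vec F (suc m) → Vec F (suc (suc m))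
    join (c ∷ g) = join′ c (squareDecomposition g)

    mon-join′ : ∀ c {g : Vec F m} (D : SquareDecomposition (mon g)) →
                mon (join′ c D) ≈ ((mon (c ∷ SquareDecomposition.root D) ⊛ mon (c ∷ SquareDecomposition.root D))
                                    ⊛ mon (SquareDecomposition.part D))
    mon-join′ c {g} D@(decomposition {k} {j} a b _ _) =
      mon-tabulate-coeff (subst (IsMonic _) (trans (+-suc-suc k j) (cong (λ x → suc (suc x)) (sym (SquareDecomposition-degree D))))
                                (a²b-IsMonic (c ∷ a) b))

    join-¬SquareFree : ∀ y → ¬ SquareFree (join y)
    join-¬SquareFree (c ∷ g) with squareDecomposition g
    ... | D@(decomposition a b _ _) = λ sf →
      SquareFree⇒SquareFreeₚ {f = join′ c D} sf (_ , s≤s z≤n , c ∷ a , ∣ₚ-respʳ (≈-sym (mon-join′ c D)) (∣ₚ-⊛ʳ _ (mon b)))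

    join-split : ∀ f → ¬ SquareFree f → join (split f) ≡ f
    join-split f ¬sf with squareDecomposition f | SquareDecomposition-degree {f = f} (squareDecomposition f)
    ... | decomposition {zero} [] b sf-b f≈b | _ =
          ⊥-elim (¬sf (SquareFreeₚ⇒SquareFree (SquareFreeₚ-resp-≈ (≈-sym f≈b′) sf-b)))
      where f≈b′ = ≈-trans f≈b (≈-trans (⊛-congˡ (mon b) (⊛-identityˡ (1# ∷ []))) (⊛-identityˡ (mon b)))
    ... | decomposition {suc k} {j} (c ∷ a₀) b sf-b f≈a²b | n≡
      with squareDecomposition (tabulate m (coeff ((mon a₀ ⊛ mon a₀) ⊛ mon b)))
    ...   | D′@(decomposition a′ b′ sf-b′ g≈a′²b′) =
            trans (tabulate-cong (suc (suc m)) (λ i → sym (at f≈ i))) (tabulate-coeff-mon f)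
      where
      g≈a₀²b : mon (tabulate m (coeff ((mon a₀ ⊛ mon a₀) ⊛ mon b))) ≈ ((mon a₀ ⊛ mon a₀) ⊛ mon b)
      g≈a₀²b = mon-tabulate-coeff (subst (IsMonic _) (ℕₚ.suc-injective (ℕₚ.suc-injective (sym (trans n≡ (+-suc-suc k j)))))
                                         (a²b-IsMonic a₀ b))
      a₀≈a′ : mon a₀ ≈ mon a′
      a₀≈a′ = squareDecomposition-unique a₀ a′ b b′ sf-b sf-b′ (≈-trans (≈-sym g≈a₀²b) g≈a′²b′)
      b≈b′ : mon b ≈ mon b′
      b≈b′ = IsMonic-⊛-cancelˡ (mon b) (mon b′) (IsMonic-⊛ (mon-IsMonic a₀) (mon-IsMonic a₀))
               (≈-trans (≈-sym g≈a₀²b) (≈-trans g≈a′²b′ (⊛-congˡ (mon b′) (≈-sym (⊛-cong a₀≈a′ a₀≈a′)))))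
      ca≈ca′ : mon (c ∷ a₀) ≈ mon (c ∷ a′)
      ca≈ca′ = ∷-cong refl a₀≈a′
      f≈ : mon f ≈ ((mon (c ∷ a′) ⊛ mon (c ∷ a′)) ⊛ mon b′)
      f≈ = ≈-trans f≈a²b (⊛-cong (⊛-cong ca≈ca′ ca≈ca′) b≈b′)

    split-join : ∀ y → split (join y) ≡ y
    split-join (c ∷ g) with squareDecomposition g
    ... | D@(decomposition a b sf-b g≈a²b) = split-of (squareDecomposition (join′ c D))
      where
      split-of : (D′ : SquareDecomposition (mon (join′ c D))) → split′ D′ ≡ c ∷ g
      split-of (decomposition a′ b′ sf-b′ e)
        with squareDecomposition-unique a′ (c ∷ a) b′ b sf-b′ sf-b (≈-trans (≈-sym e) (mon-join′ c D))
      split-of (decomposition {zero}  []         b′ sf-b′ e) | a′≈ca =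
        ⊥-elim (0≢1+n (IsMonic-degree-unique (mon-IsMonic []) (IsMonic-resp-≈ (≈-sym a′≈ca) (mon-IsMonic (c ∷ a)))))
        where 0≢1+n : ∀ {x} → 0 ≢ suc x
              0≢1+n ()
      split-of (decomposition {suc _} (c′ ∷ a′) b′ sf-b′ e) | a′≈ca =
        cong₂ _∷_ (∷-injectiveˡ a′≈ca) (trans (tabulate-cong m (at a′²b′≈g)) (tabulate-coeff-mon g))
        where
        b′≈b : mon b′ ≈ mon b
        b′≈b = IsMonic-⊛-cancelˡ (mon b′) (mon b) (IsMonic-⊛ (mon-IsMonic (c′ ∷ a′)) (mon-IsMonic (c′ ∷ a′)))
                 (≈-trans (≈-sym e) (≈-trans (mon-join′ c D) (⊛-congˡ (mon b) (≈-sym (⊛-cong a′≈ca a′≈ca)))))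
        a′²b′≈g : ((mon a′ ⊛ mon a′) ⊛ mon b′) ≈ mon g
        a′²b′≈g = ≈-trans (⊛-cong (⊛-cong (∷-injectiveʳ a′≈ca) (∷-injectiveʳ a′≈ca)) b′≈b) (≈-sym g≈a²b)

    count-¬SquareFree : count (λ f → ¬? (squareFree? f)) (allMonic (suc (suc m))) ≡ q ^ suc m
    count-¬SquareFree =
      trans (count-bijection (λ f → ¬? (squareFree? f)) (λ _ → yes tt) (allMonic-unique _) (allMonic-unique _)
                             (allMonic-complete _) (allMonic-complete _)
                             split join (λ _ _ → tt) (λ y _ → join-¬SquareFree y) join-split (λ y _ → split-join y))
            (trans (count-all (λ _ → yes tt) (allMonic (suc m)) (λ _ → tt)) (length-allMonic (suc m)))

  #P+q^n-1≡q^n : ∀ m → #P (suc (suc m)) ℕ.+ q ^ suc m ≡ q ^ suc (suc m)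
  #P+q^n-1≡q^n m = trans (cong (#P (suc (suc m)) ℕ.+_) (sym (NonSquareFree.count-¬SquareFree m)))
                          (trans (count-complement squareFree? (allMonic (suc (suc m)))) (length-allMonic (suc (suc m))))

  q-1 : ℕ
  q-1 = ℕ.pred q

  q≡1+[q-1] : q ≡ suc q-1
  q≡1+[q-1] with q | 2≤q
  ... | suc _ | _ = refl

  #P-0 : #P 0 ≡ 1
  #P-0 = #P-degree≤1 0 z≤n

  #P-1 : #P 1 ≡ suc q-1
  #P-1 = trans (#P-degree≤1 1 (s≤s z≤n)) (trans (ℕₚ.*-identityʳ q) q≡1+[q-1])

  #P-suc-suc : ∀ m → #P (suc (suc m)) ≡ q-1 ℕ.* q ^ suc m
  #P-suc-suc m = ℕₚ.+-cancelʳ-≡ (q ^ suc m) _ _ (trans (#P+q^n-1≡q^n m) q^2+m≡)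
    where
    q^2+m≡ : q ^ suc (suc m) ≡ q-1 ℕ.* q ^ suc m ℕ.+ q ^ suc m
    q^2+m≡ = trans (cong (λ x → x ℕ.* q ^ suc m) q≡1+[q-1]) (ℕₚ.+-comm (q ^ suc m) (q-1 ℕ.* q ^ suc m))


module MultiplesCount (K : FiniteField) where

  open import Data.Nat as ℕ using (ℕ; _≤_; _<_; _∸_)
  open import Data.Vec using (Vec)
  import Data.Nat.Properties as ℕₚ
  open import Data.Product using (_×_; _,_; proj₁; proj₂)
  open import Data.Empty using (⊥-elim)
  open import Relation.Nullary using (¬_; yes; no; Dec)
  open import Relation.Nullary.Decidable using (_×-dec_; ¬?)
  open import Relation.Binary.PropositionalEquality hiding ([_])
  open FiniteField K
  open Poly K
  open PolynomialArithmetic K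
  open Degree K
  open Divisibility K
  open Monic K
  open SquareFreeness K
  open SquareDecomposition K
  open Counting
  open MonicEnumeration K
  open SquareFreeCount K

  module _ {d} (g : Vec F d) where

    #P-∣ : ℕ → ℕ
    #P-∣ m = count (λ f → squareFree? f ×-dec g ∣? f) (allMonic m)

    #P-∤ : ℕ → ℕ
    #P-∤ m = count (λ f → squareFree? f ×-dec ¬? (g ∣? f)) (allMonic m)

    #P≡#P-∣+#P-∤ : ∀ m → #P m ≡ #P-∣ m ℕ.+ #P-∤ m
    #P≡#P-∣+#P-∤ m = count-split squareFree? (λ f → g ∣? f) (allMonic m)

    #P-∣-< : ∀ m → m < d → #P-∣ m ≡ 0
    #P-∣-< m m<d = count-none _ (allMonic m) (λ f (_ , d≤m , _) → ℕₚ.<-irrefl refl (ℕₚ.≤-trans m<d d≤m))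

    -- For irreducible g, f ↦ f / g maps the square-free multiples of g bijectively onto the square-free
    -- polynomials of degree m - d that g does not divide.
    module _ (irr : Irreducible g) (m : ℕ) (d≤m : d ≤ m) where

      private
        times-g : Vec F (m ∸ d) → Vec F m
        times-g h = tabulate m (coeff (mon g ⊛ mon h))

        mon-times-g : ∀ h → mon (times-g h) ≈ (mon g ⊛ mon h)
        mon-times-g h = mon-tabulate-coeff (subst (IsMonic (mon g ⊛ mon h)) (ℕₚ.m+[n∸m]≡n d≤m)
                                                  (IsMonic-⊛ (mon-IsMonic g) (mon-IsMonic h)))

        quotient′ : ∀ {f : Vec F m} → Dec (g ∣ f) → Vec F (m ∸ d)
        quotient′ (yes (_ , h , _)) = h
        quotient′ (no _)            = tabulate (m ∸ d) (λ _ → 0#)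

        quotient : Vec F m → Vec F (m ∸ d)
        quotient f = quotient′ (g ∣? f)

        times-g-sf : ∀ h → SquareFree h × ¬ (g ∣ h) → SquareFree (times-g h) × g ∣ times-g h
        times-g-sf h (sf , g∤h) =
          SquareFreeₚ⇒SquareFree (SquareFreeₚ-resp-≈ (≈-sym (mon-times-g h))
            (SquareFreeₚ-⊛-irreducible irr (SquareFree⇒SquareFreeₚ sf) (λ x → g∤h (∣ₚ⇒∣ {g = g} x)))) ,
          ∣ₚ⇒∣ {g = g} (mon h , mon-times-g h)

        quotient-sf : ∀ f → SquareFree f × g ∣ f → SquareFree (quotient f) × ¬ (g ∣ quotient f)
        quotient-sf f (sf , g∣f) with g ∣? f
        ... | no g∤f = ⊥-elim (g∤f g∣f)
        ... | yes (_ , h , gh≡f) =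
              SquareFreeₚ⇒SquareFree (SquareFreeₚ-factor {G = mon g} (SquareFree⇒SquareFreeₚ sf) f≈gh) ,
              λ g∣h → SquareFreeₚ⇒∤cofactor {g = g} (proj₁ irr) (SquareFree⇒SquareFreeₚ sf) f≈gh (∣⇒∣ₚ {g = g} g∣h)
          where f≈gh = ≈-sym (≈-reflexive gh≡f)

        quotient-times-g : ∀ h → SquareFree h × ¬ (g ∣ h) → quotient (times-g h) ≡ h
        quotient-times-g h p with g ∣? times-g h
        ... | no g∤gh = ⊥-elim (g∤gh (proj₂ (times-g-sf h p)))
        ... | yes (_ , h′ , gh′≡gh) = mon-injective (IsMonic-⊛-cancelˡ (mon h′) (mon h) (mon-IsMonic g)
                                        (≈-trans (≈-reflexive gh′≡gh) (mon-times-g h)))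

        times-g-quotient : ∀ f → SquareFree f × g ∣ f → times-g (quotient f) ≡ f
        times-g-quotient f (_ , g∣f) with g ∣? f
        ... | no g∤f = ⊥-elim (g∤f g∣f)
        ... | yes (_ , h , gh≡f) = trans (tabulate-cong m (λ i → cong (λ x → coeff x i) gh≡f)) (tabulate-coeff-mon f)

      #P-∣-≥ : #P-∣ m ≡ #P-∤ (m ∸ d)
      #P-∣-≥ = count-bijection _ _ (allMonic-unique _) (allMonic-unique _) (allMonic-complete _) (allMonic-complete _)
                 quotient times-g quotient-sf times-g-sf times-g-quotient quotient-times-g


module Within where

  open import Data.Nat as ℕ using (ℕ; zero; suc; _≤_; _<_; z≤n; s≤s; _∸_; _^_; _+_; _*_)
  import Data.Nat.Properties as ℕₚ
  open import Data.Nat.Solver using (module +-*-Solver)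
  open +-*-Solver using (solve; _:=_; _:+_; _:*_; con)
  open import Data.Nat.ListAction using (sum)
  open import Data.List using ([]; _∷_; map)
  open import Data.List.Membership.Propositional using (_∈_)
  open import Data.List.Relation.Unary.Any using (here; there)
  open import Data.Product using (_×_; _,_)
  open import Relation.Nullary using (yes; no)
  open import Relation.Binary.PropositionalEquality

  -- ∣ x - u ∣ ≤ B, without subtraction.
  Within : ℕ → ℕ → ℕ → Set
  Within B x u = x ≤ u + B × u ≤ x + B

  within-≡ : ∀ {x u e B} → x ≡ u + e → e ≤ B → Within B x u
  within-≡ {x} {u} {e} {B} refl e≤B = ℕₚ.+-monoʳ-≤ u e≤B , ℕₚ.≤-trans (ℕₚ.m≤m+n u e) (ℕₚ.m≤m+n (u + e) B)

  within-reflect : ∀ {x y u v B} → x + y ≡ u + v → Within B y v → Within B x u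
  within-reflect {x} {y} {u} {v} {B} e (y≤v+B , v≤y+B) =
    ℕₚ.+-cancelʳ-≤ y x (u + B) (ℕₚ.≤-trans (ℕₚ.≤-reflexive e) (ℕₚ.≤-trans (ℕₚ.+-monoʳ-≤ u v≤y+B)
      (ℕₚ.≤-reflexive (solve 3 (λ u y B → u :+ (y :+ B) := (u :+ B) :+ y) refl u y B)))) ,
    ℕₚ.+-cancelʳ-≤ v u (x + B) (ℕₚ.≤-trans (ℕₚ.≤-reflexive (sym e)) (ℕₚ.≤-trans (ℕₚ.+-monoʳ-≤ x y≤v+B)
      (ℕₚ.≤-reflexive (solve 3 (λ x v B → x :+ (v :+ B) := (x :+ B) :+ v) refl x v B))))

  within-+ : ∀ {x₁ u₁ B₁ x₂ u₂ B₂} → Within B₁ x₁ u₁ → Within B₂ x₂ u₂ → Within (B₁ + B₂) (x₁ + x₂) (u₁ + u₂)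
  within-+ {x₁} {u₁} {B₁} {x₂} {u₂} {B₂} (a , b) (c , d) =
    ℕₚ.≤-trans (ℕₚ.+-mono-≤ a c) (ℕₚ.≤-reflexive (interchange u₁ B₁ u₂ B₂)) ,
    ℕₚ.≤-trans (ℕₚ.+-mono-≤ b d) (ℕₚ.≤-reflexive (interchange x₁ B₁ x₂ B₂))
    where
    interchange : ∀ u B v C → (u + B) + (v + C) ≡ (u + v) + (B + C)
    interchange = solve 4 (λ u B v C → (u :+ B) :+ (v :+ C) := (u :+ v) :+ (B :+ C)) refl

  within-sum : ∀ {A : Set} (B X U : A → ℕ) ys → (∀ y → y ∈ ys → Within (B y) (X y) (U y)) →
               Within (sum (map B ys)) (sum (map X ys)) (sum (map U ys))
  within-sum B X U []       h = z≤n , z≤n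
  within-sum B X U (y ∷ ys) h = within-+ (h y (here refl)) (within-sum B X U ys (λ y′ m → h y′ (there m)))

  1≤1+n^m : ∀ n m → 1 ≤ suc n ^ m
  1≤1+n^m n m = ℕₚ.^-monoʳ-≤ (suc n) (z≤n {m})

  -- Q = 1 + q-1 and d = 1 + d-1.  Since W m + W (m - d) = (Q ^ d + 1) S m, the error of
  -- (Q ^ d + 1) A m against W m changes sign along m, m - d, m - 2d, …, so it is bounded by its
  -- size for m < d, where A m = S m.
  module ReflectedRecurrence (q-1 d-1 : ℕ) (A S : ℕ → ℕ)
    (S-0 : S 0 ≡ 1) (S-1 : S 1 ≡ suc q-1) (S-suc-suc : ∀ m → S (suc (suc m)) ≡ q-1 * suc q-1 ^ suc m)
    (A-< : ∀ m → m < suc d-1 → A m ≡ S m)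
    (A-≥ : ∀ m → suc d-1 ≤ m → A m + A (m ∸ suc d-1) ≡ S m) where

    private
      Q = suc q-1
      d = suc d-1
      P = Q ^ d-1

      Q≤Q^d : Q ≤ Q ^ d
      Q≤Q^d = ℕₚ.≤-trans (ℕₚ.≤-reflexive (sym (ℕₚ.*-identityʳ Q))) (ℕₚ.*-monoʳ-≤ Q (1≤1+n^m q-1 d-1))

      ≤-+-≤ : ∀ {a c b} → a ≤ b → c ≤ b → a + c ≤ 2 * b
      ≤-+-≤ {b = b} a≤b c≤b = ℕₚ.≤-trans (ℕₚ.+-mono-≤ a≤b c≤b) (ℕₚ.≤-reflexive (cong (b +_) (sym (ℕₚ.+-identityʳ b))))

      ≤-2* : ∀ {a b} → a ≤ b → a ≤ 2 * b
      ≤-2* {a} {b} a≤b = ℕₚ.≤-trans a≤b (ℕₚ.m≤m+n b (b + 0))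

    W : ℕ → ℕ
    W m = P * (q-1 * Q ^ m)

    within-< : ∀ m → m < d → Within (2 * Q ^ d) ((Q ^ d + 1) * A m) (W m)
    within-< zero lt rewrite A-< 0 lt | S-0 =
      within-≡ (solve 2 (λ q p → ((con 1 :+ q) :* p :+ con 1) :* con 1 := p :* (q :* con 1) :+ (p :+ con 1)) refl q-1 P)
        (≤-+-≤ (ℕₚ.m≤n*m P Q) (1≤1+n^m q-1 d))
    within-< (suc zero) lt rewrite A-< 1 lt | S-1 =
      within-≡ (solve 2 (λ q p → ((con 1 :+ q) :* p :+ con 1) :* (con 1 :+ q)
                                  := p :* (q :* ((con 1 :+ q) :* con 1)) :+ ((con 1 :+ q) :* p :+ (con 1 :+ q))) refl q-1 P)
        (≤-+-≤ ℕₚ.≤-refl Q≤Q^d)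
    within-< (suc (suc m)) lt rewrite A-< (suc (suc m)) lt | S-suc-suc m =
      within-≡ (solve 3 (λ q p t → ((con 1 :+ q) :* p :+ con 1) :* (q :* t) := p :* (q :* ((con 1 :+ q) :* t)) :+ q :* t) refl q-1 P (Q ^ suc m))
        (≤-2* (ℕₚ.≤-trans (ℕₚ.*-monoˡ-≤ (Q ^ suc m) (ℕₚ.n≤1+n q-1)) (ℕₚ.^-monoʳ-≤ Q (ℕₚ.<⇒≤ lt))))

    within-1 : d-1 ≡ 0 → Within (2 * Q ^ d) ((Q ^ d + 1) * A 1) (W 1)
    within-1 refl = within-≡ (trans (cong ((Q ^ d + 1) *_) A-1)
                                     (solve 1 (λ q → ((con 1 :+ q) :* con 1 :+ con 1) :* q
                                                     := con 1 :* (q :* ((con 1 :+ q) :* con 1)) :+ q) refl q-1))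
                             (≤-2* (ℕₚ.≤-trans (ℕₚ.n≤1+n q-1) Q≤Q^d))
      where
      A-1 : A 1 ≡ q-1
      A-1 = ℕₚ.+-cancelʳ-≡ 1 (A 1) q-1
              (trans (cong (A 1 +_) (sym (trans (A-< 0 (s≤s z≤n)) S-0))) (trans (A-≥ 1 (s≤s z≤n)) (trans S-1 (ℕₚ.+-comm 1 q-1))))

    W-reflect : ∀ m → d ≤ suc (suc m) → (Q ^ d + 1) * S (suc (suc m)) ≡ W (suc (suc m)) + W (suc (suc m) ∸ d)
    W-reflect m d≤m = begin
      (Q ^ d + 1) * S (suc (suc m))      ≡⟨ cong ((Q ^ d + 1) *_) (S-suc-suc m) ⟩
      (Q ^ d + 1) * (q-1 * Q ^ suc m)    ≡⟨ cong (λ z → (Q ^ d + 1) * (q-1 * z)) Q^1+m ⟩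
      (Q * P + 1) * (q-1 * (P * Q ^ t))  ≡⟨ solve 3 (λ q p x → ((con 1 :+ q) :* p :+ con 1) :* (q :* (p :* x))
                                                     := p :* (q :* ((con 1 :+ q) :* (p :* x))) :+ p :* (q :* x)) refl q-1 P (Q ^ t) ⟩
      P * (q-1 * (Q * (P * Q ^ t))) + P * (q-1 * Q ^ t) ≡⟨ cong (λ z → P * (q-1 * (Q * z)) + W t) (sym Q^1+m) ⟩
      W (suc (suc m)) + W t              ∎
      where
      open ≡-Reasoning
      t = suc (suc m) ∸ d
      Q^1+m : Q ^ suc m ≡ P * Q ^ t
      Q^1+m = trans (cong (Q ^_) (trans (sym (ℕₚ.m∸n+n≡m (ℕₚ.≤-pred d≤m))) (ℕₚ.+-comm (suc m ∸ d-1) d-1)))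
                    (ℕₚ.^-distribˡ-+-* Q d-1 t)

    within : ∀ m → Within (2 * Q ^ d) ((Q ^ d + 1) * A m) (W m)
    within m = <-rec (λ m → Within (2 * Q ^ d) ((Q ^ d + 1) * A m) (W m)) step m
      where
      open import Data.Nat.Induction using (<-rec)
      step : ∀ m → (∀ {m′} → m′ < m → Within (2 * Q ^ d) ((Q ^ d + 1) * A m′) (W m′)) → _
      step m rec with m ℕₚ.<? d
      ... | yes m<d = within-< m m<d
      ... | no m≮d with ℕₚ.≮⇒≥ m≮d
      step zero          rec | no _ | ()
      step (suc zero)    rec | no _ | s≤s d-1≤0 = within-1 (ℕₚ.n≤0⇒n≡0 d-1≤0)
      step (suc (suc m)) rec | no _ | d≤m =
        within-reflect {y = (Q ^ d + 1) * A (suc (suc m) ∸ d)}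
          (trans (sym (ℕₚ.*-distribˡ-+ (Q ^ d + 1) _ _)) (trans (cong ((Q ^ d + 1) *_) (A-≥ (suc (suc m)) d≤m)) (W-reflect m d≤m)))
          (rec (s≤s (ℕₚ.m∸n≤m (suc m) d-1)))


module RationalEstimates where

  open import Data.Nat as ℕ using (ℕ; zero; suc)
  import Data.Nat.Properties as ℕₚ
  open import Data.Nat.ListAction using (sum)
  open import Data.Integer as ℤ using (+_)
  import Data.Integer.Properties as ℤₚ
  open import Data.Rational as ℚ
    using (ℚ; 0ℚ; 1ℚ; toℚᵘ; _≤_; ∣_∣; _-_; _+_; _*_; -_; Positive; NonNegative)
  import Data.Rational.Properties as ℚₚ
  open import Data.Rational.Unnormalised as ℚᵘ using (mkℚᵘ; *≡*; *≤*)
  import Data.Rational.Unnormalised.Properties as ℚᵘₚ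
  open import Data.Rational.Solver using (module +-*-Solver)
  open +-*-Solver using (solve; _:=_; _:+_; _:*_; :-_; _:-_)
  open import Data.List using (List; []; _∷_; map; foldr)
  open import Data.List.Membership.Propositional using (_∈_)
  open import Data.List.Relation.Unary.Any using (here; there)
  open import Data.Product using (_,_)
  open import Data.Sum using (inj₁; inj₂)
  open import Relation.Nullary using (yes; no)
  open import Relation.Binary.PropositionalEquality
  open Within using (Within)

  toℚ : ℕ → ℚ
  toℚ a = a /ℕ 1

  private
    toℚᵘ-/ℕ : ∀ a b → toℚᵘ (a /ℕ suc b) ℚᵘ.≃ mkℚᵘ (+ a) b
    toℚᵘ-/ℕ a b = ℚₚ.toℚᵘ-fromℚᵘ (mkℚᵘ (+ a) b)

  toℚ-+ : ∀ a b → toℚ (a ℕ.+ b) ≡ toℚ a + toℚ b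
  toℚ-+ a b = ℚₚ.toℚᵘ-injective (ℚᵘₚ.≃-trans (toℚᵘ-/ℕ (a ℕ.+ b) 0) (ℚᵘₚ.≃-trans +≃
    (ℚᵘₚ.≃-sym (ℚᵘₚ.≃-trans (ℚₚ.toℚᵘ-homo-+ (toℚ a) (toℚ b)) (ℚᵘₚ.+-cong (toℚᵘ-/ℕ a 0) (toℚᵘ-/ℕ b 0))))))
    where
    +≃ : mkℚᵘ (+ (a ℕ.+ b)) 0 ℚᵘ.≃ (mkℚᵘ (+ a) 0 ℚᵘ.+ mkℚᵘ (+ b) 0)
    +≃ = *≡* (cong (ℤ._* (+ 1)) (cong₂ ℤ._+_ (sym (ℤₚ.*-identityʳ (+ a))) (sym (ℤₚ.*-identityʳ (+ b)))))

  toℚ-* : ∀ a b → toℚ (a ℕ.* b) ≡ toℚ a * toℚ b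
  toℚ-* a b = ℚₚ.toℚᵘ-injective (ℚᵘₚ.≃-trans (toℚᵘ-/ℕ (a ℕ.* b) 0) (ℚᵘₚ.≃-trans *≃
    (ℚᵘₚ.≃-sym (ℚᵘₚ.≃-trans (ℚₚ.toℚᵘ-homo-* (toℚ a) (toℚ b)) (ℚᵘₚ.*-cong (toℚᵘ-/ℕ a 0) (toℚᵘ-/ℕ b 0))))))
    where
    *≃ : mkℚᵘ (+ (a ℕ.* b)) 0 ℚᵘ.≃ (mkℚᵘ (+ a) 0 ℚᵘ.* mkℚᵘ (+ b) 0)
    *≃ = *≡* (trans (ℤₚ.*-identityʳ _) (trans (ℤₚ.pos-* a b) (sym (ℤₚ.*-identityʳ _))))

  toℚ-mono-≤ : ∀ {a b} → a ℕ.≤ b → toℚ a ≤ toℚ b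
  toℚ-mono-≤ {a} {b} a≤b = ℚₚ.toℚᵘ-cancel-≤ (ℚᵘₚ.≤-respʳ-≃ (ℚᵘₚ.≃-sym (toℚᵘ-/ℕ b 0))
    (ℚᵘₚ.≤-respˡ-≃ (ℚᵘₚ.≃-sym (toℚᵘ-/ℕ a 0)) (*≤* (ℤₚ.*-monoʳ-≤-nonNeg (+ 1) (ℤ.+≤+ a≤b)))))

  toℚ-suc-positive : ∀ a → Positive (toℚ (suc a))
  toℚ-suc-positive a = ℚ.positive (ℚₚ.toℚᵘ-cancel-< (ℚᵘₚ.<-respʳ-≃ (ℚᵘₚ.≃-sym (toℚᵘ-/ℕ (suc a) 0))
                                                     (ℚᵘ.*<* (ℤ.+<+ (ℕ.s≤s ℕ.z≤n)))))

  toℚ-nonNegative : ∀ a → NonNegative (toℚ a)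
  toℚ-nonNegative a = ℚ.nonNegative (toℚ-mono-≤ {0} {a} ℕ.z≤n)

  /ℕ-nonNegative : ∀ a b → NonNegative (a /ℕ b)
  /ℕ-nonNegative a zero    = _
  /ℕ-nonNegative a (suc b) = ℚₚ.normalize-nonNeg a (suc b)

  /ℕ-*-toℚ : ∀ a b → (a /ℕ suc b) * toℚ (suc b) ≡ toℚ a
  /ℕ-*-toℚ a b = ℚₚ.toℚᵘ-injective (ℚᵘₚ.≃-trans (ℚₚ.toℚᵘ-homo-* (a /ℕ suc b) (toℚ (suc b)))
    (ℚᵘₚ.≃-trans (ℚᵘₚ.*-cong (toℚᵘ-/ℕ a b) (toℚᵘ-/ℕ (suc b) 0))
    (ℚᵘₚ.≃-trans (*≡* (ℤₚ.*-assoc (+ a) (+ suc b) (+ 1))) (ℚᵘₚ.≃-sym (toℚᵘ-/ℕ a 0)))))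

  *-cancelʳ-≡-pos : ∀ {p p′} r .{{_ : Positive r}} → p * r ≡ p′ * r → p ≡ p′
  *-cancelʳ-≡-pos r e =
    ℚₚ.≤-antisym (ℚₚ.*-cancelʳ-≤-pos r (ℚₚ.≤-reflexive e)) (ℚₚ.*-cancelʳ-≤-pos r (ℚₚ.≤-reflexive (sym e)))

  ≡-/ℕ : ∀ x a s → x * toℚ (suc s) ≡ toℚ a → x ≡ a /ℕ suc s
  ≡-/ℕ x a s e = *-cancelʳ-≡-pos (toℚ (suc s)) {{toℚ-suc-positive s}} (trans e (sym (/ℕ-*-toℚ a s)))

  private
    ≤+⇒-≤ : ∀ {a b c} → a ≤ b + c → a - b ≤ c
    ≤+⇒-≤ {a} {b} {c} h = ℚₚ.≤-trans (ℚₚ.+-monoˡ-≤ (- b) h) (ℚₚ.≤-reflexive (solve 2 (λ b c → (b :+ c) :- b := c) refl b c))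

  ∣-∣≤ : ∀ {a b c} → a ≤ b + c → b ≤ a + c → ∣ a - b ∣ ≤ c
  ∣-∣≤ {a} {b} {c} a≤b+c b≤a+c with ℚₚ.∣p∣≡p∨∣p∣≡-p (a - b)
  ... | inj₁ e = ℚₚ.≤-trans (ℚₚ.≤-reflexive e) (≤+⇒-≤ a≤b+c)
  ... | inj₂ e = ℚₚ.≤-trans (ℚₚ.≤-reflexive (trans e (solve 2 (λ a b → :- (a :- b) := b :- a) refl a b))) (≤+⇒-≤ b≤a+c)

  Within⇒∣toℚ-toℚ∣≤ : ∀ {B x u} → Within B x u → ∣ toℚ x - toℚ u ∣ ≤ toℚ B
  Within⇒∣toℚ-toℚ∣≤ {B} {x} {u} (x≤u+B , u≤x+B) =
    ∣-∣≤ (subst (toℚ x ≤_) (toℚ-+ u B) (toℚ-mono-≤ x≤u+B)) (subst (toℚ u ≤_) (toℚ-+ x B) (toℚ-mono-≤ u≤x+B))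

  ∣/ℕ-/ℕ∣≤ : ∀ y π s c B K → Within B (suc c ℕ.* y) (π ℕ.* suc s) → B ℕ.≤ K ℕ.* suc c →
             ∣ y /ℕ suc s - π /ℕ suc c ∣ ≤ toℚ K * (1 /ℕ suc s)
  ∣/ℕ-/ℕ∣≤ y π s c B K within B≤Kc = ℚₚ.*-cancelʳ-≤-pos (S * C) {{S*C-positive}} (begin
    ∣ y′ - π′ ∣ * (S * C)
      ≡⟨ cong (∣ y′ - π′ ∣ *_) (ℚₚ.0≤p⇒∣p∣≡p (ℚₚ.nonNegative⁻¹ (S * C) {{S*C-nonNegative}})) ⟨
    ∣ y′ - π′ ∣ * ∣ S * C ∣
      ≡⟨ ℚₚ.∣p*q∣≡∣p∣*∣q∣ (y′ - π′) (S * C) ⟨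
    ∣ (y′ - π′) * (S * C) ∣
      ≡⟨ cong ∣_∣ (solve 4 (λ y p a b → (y :- p) :* (a :* b) := b :* (y :* a) :- (p :* b) :* a) refl y′ π′ S C) ⟩
    ∣ C * (y′ * S) - (π′ * C) * S ∣
      ≡⟨ cong₂ (λ u v → ∣ C * u - v * S ∣) (/ℕ-*-toℚ y s) (/ℕ-*-toℚ π c) ⟩
    ∣ C * toℚ y - toℚ π * S ∣
      ≡⟨ cong₂ (λ u v → ∣ u - v ∣) (toℚ-* (suc c) y) (toℚ-* π (suc s)) ⟨
    ∣ toℚ (suc c ℕ.* y) - toℚ (π ℕ.* suc s) ∣
      ≤⟨ Within⇒∣toℚ-toℚ∣≤ within ⟩
    toℚ B
      ≤⟨ toℚ-mono-≤ B≤Kc ⟩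
    toℚ (K ℕ.* suc c)
      ≡⟨ toℚ-* K (suc c) ⟩
    toℚ K * C
      ≡⟨ ℚₚ.*-identityʳ (toℚ K * C) ⟨
    toℚ K * C * 1ℚ
      ≡⟨ cong (toℚ K * C *_) (/ℕ-*-toℚ 1 s) ⟨
    toℚ K * C * (1 /ℕ suc s * S)
      ≡⟨ solve 4 (λ k c r s → (k :* c) :* (r :* s) := (k :* r) :* (s :* c)) refl (toℚ K) C (1 /ℕ suc s) S ⟩
    toℚ K * (1 /ℕ suc s) * (S * C)             ∎)
    where
    open ℚₚ.≤-Reasoning
    y′ = y /ℕ suc s
    π′ = π /ℕ suc c
    S = toℚ (suc s)
    C = toℚ (suc c)
    S*C-positive : Positive (S * C)
    S*C-positive = ℚₚ.pos*pos⇒pos S {{toℚ-suc-positive s}} C {{toℚ-suc-positive c}}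
    S*C-nonNegative : NonNegative (S * C)
    S*C-nonNegative = ℚₚ.nonNeg*nonNeg⇒nonNeg S {{toℚ-nonNegative (suc s)}} C {{toℚ-nonNegative (suc c)}}

  sumℚ : List ℕ → (ℕ → ℚ) → ℚ
  sumℚ ds f = foldr _+_ 0ℚ (map f ds)

  ∣sumℚ-sumℚ∣≤ : ∀ ds (f g : ℕ → ℚ) (K : ℕ → ℕ) r → .{{NonNegative r}} →
                 (∀ d → d ∈ ds → ∣ f d - g d ∣ ≤ toℚ (K d) * r) →
                 ∣ sumℚ ds f - sumℚ ds g ∣ ≤ toℚ (sum (map K ds)) * r
  ∣sumℚ-sumℚ∣≤ []       f g K r h = ℚₚ.≤-reflexive (sym (ℚₚ.*-zeroˡ r))
  ∣sumℚ-sumℚ∣≤ (d ∷ ds) f g K r h = begin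
    ∣ (f d + sumℚ ds f) - (g d + sumℚ ds g) ∣
      ≡⟨ cong ∣_∣ (solve 4 (λ a b c e → (a :+ b) :- (c :+ e) := (a :- c) :+ (b :- e))
                                                                     refl (f d) (sumℚ ds f) (g d) (sumℚ ds g)) ⟩
    ∣ (f d - g d) + (sumℚ ds f - sumℚ ds g) ∣
      ≤⟨ ℚₚ.∣p+q∣≤∣p∣+∣q∣ (f d - g d) (sumℚ ds f - sumℚ ds g) ⟩
    ∣ f d - g d ∣ + ∣ sumℚ ds f - sumℚ ds g ∣
      ≤⟨ ℚₚ.+-mono-≤ (h d (here refl)) (∣sumℚ-sumℚ∣≤ ds f g K r (λ d′ m → h d′ (there m))) ⟩
    toℚ (K d) * r + toℚ (sum (map K ds)) * r
      ≡⟨ ℚₚ.*-distribʳ-+ r (toℚ (K d)) (toℚ (sum (map K ds))) ⟨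
    (toℚ (K d) + toℚ (sum (map K ds))) * r
      ≡⟨ cong (_* r) (toℚ-+ (K d) (sum (map K ds))) ⟨
    toℚ (sum (map K (d ∷ ds))) * r                    ∎
    where open ℚₚ.≤-Reasoning

  sum-/ℕ : ∀ ds (Y : ℕ → ℕ) s → sum (map Y ds) /ℕ suc s ≡ sumℚ ds (λ d → Y d /ℕ suc s)
  sum-/ℕ ds Y s = sym (≡-/ℕ (sumℚ ds (λ d → Y d /ℕ suc s)) (sum (map Y ds)) s (sum-* ds))
    where
    sum-* : ∀ ds → sumℚ ds (λ d → Y d /ℕ suc s) * toℚ (suc s) ≡ toℚ (sum (map Y ds))
    sum-* []       = ℚₚ.*-zeroˡ (toℚ (suc s))
    sum-* (d ∷ ds) = trans (ℚₚ.*-distribʳ-+ (toℚ (suc s)) (Y d /ℕ suc s) (sumℚ ds (λ d → Y d /ℕ suc s)))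
                           (trans (cong₂ _+_ (/ℕ-*-toℚ (Y d) s) (sum-* ds)) (sym (toℚ-+ (Y d) (sum (map Y ds)))))

  1/ℕ-*-toℚ-* : ∀ c m → 1 ℕ.≤ c → (1 /ℕ c) * toℚ (c ℕ.* m) ≡ toℚ m
  1/ℕ-*-toℚ-* (suc c) m _ = begin
    (1 /ℕ suc c) * toℚ (suc c ℕ.* m)        ≡⟨ cong ((1 /ℕ suc c) *_) (toℚ-* (suc c) m) ⟩
    (1 /ℕ suc c) * (toℚ (suc c) * toℚ m)    ≡⟨ ℚₚ.*-assoc (1 /ℕ suc c) (toℚ (suc c)) (toℚ m) ⟨
    (1 /ℕ suc c) * toℚ (suc c) * toℚ m      ≡⟨ cong (_* toℚ m) (/ℕ-*-toℚ 1 c) ⟩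
    1ℚ * toℚ m                              ≡⟨ ℚₚ.*-identityˡ (toℚ m) ⟩
    toℚ m                                   ∎
    where open ≡-Reasoning

  powℤ-*-^ : ∀ q a b → 1 ℕ.≤ q → powℤ q a b * toℚ (q ℕ.^ b) ≡ toℚ (q ℕ.^ a)
  powℤ-*-^ q a b 1≤q with b ℕ.≤? a
  ... | yes b≤a = begin
    toℚ (q ℕ.^ (a ℕ.∸ b)) * toℚ (q ℕ.^ b)    ≡⟨ toℚ-* (q ℕ.^ (a ℕ.∸ b)) (q ℕ.^ b) ⟨
    toℚ (q ℕ.^ (a ℕ.∸ b) ℕ.* q ℕ.^ b)        ≡⟨ cong toℚ (ℕₚ.^-distribˡ-+-* q (a ℕ.∸ b) b) ⟨
    toℚ (q ℕ.^ (a ℕ.∸ b ℕ.+ b))              ≡⟨ cong (λ e → toℚ (q ℕ.^ e)) (ℕₚ.m∸n+n≡m b≤a) ⟩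
    toℚ (q ℕ.^ a)                            ∎
    where open ≡-Reasoning
  ... | no b≰a = begin
    (1 /ℕ c) * toℚ (q ℕ.^ b)          ≡⟨ cong (λ e → (1 /ℕ c) * toℚ e) q^b≡c*q^a ⟩
    (1 /ℕ c) * toℚ (c ℕ.* q ℕ.^ a)    ≡⟨ 1/ℕ-*-toℚ-* c (q ℕ.^ a) (ℕₚ.m^n>0 q {{ℕ.>-nonZero 1≤q}} (b ℕ.∸ a)) ⟩
    toℚ (q ℕ.^ a)                     ∎
    where
    open ≡-Reasoning
    c = q ℕ.^ (b ℕ.∸ a)
    q^b≡c*q^a : q ℕ.^ b ≡ c ℕ.* q ℕ.^ a
    q^b≡c*q^a = trans (cong (q ℕ.^_) (sym (ℕₚ.m∸n+n≡m (ℕₚ.<⇒≤ (ℕₚ.≰⇒> b≰a))))) (ℕₚ.^-distribˡ-+-* q (b ℕ.∸ a) a)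

  private
    q^T*q^T*q≡q^[2T+1] : ∀ q T → q ℕ.^ T ℕ.* q ℕ.^ T ℕ.* q ≡ q ℕ.^ (2 ℕ.* T ℕ.+ 1)
    q^T*q^T*q≡q^[2T+1] q T = begin
      q ℕ.^ T ℕ.* q ℕ.^ T ℕ.* q          ≡⟨ cong (ℕ._* q) (ℕₚ.^-distribˡ-+-* q T T) ⟨
      q ℕ.^ (T ℕ.+ T) ℕ.* q              ≡⟨ ℕₚ.*-comm (q ℕ.^ (T ℕ.+ T)) q ⟩
      q ℕ.^ suc (T ℕ.+ T)                ≡⟨ cong (q ℕ.^_) (ℕₚ.+-comm 1 (T ℕ.+ T)) ⟩
      q ℕ.^ (T ℕ.+ T ℕ.+ 1)              ≡⟨ cong (λ e → q ℕ.^ (T ℕ.+ e ℕ.+ 1)) (ℕₚ.+-identityʳ T) ⟨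
      q ℕ.^ (2 ℕ.* T ℕ.+ 1)              ∎
      where open ≡-Reasoning

  -- Multiply by q (s + 1) and use powℤ q (2T + 1) (n + 1) · q ^ (n + 1) = q ^ (2T + 1).
  /ℕ-≤-powℤ : ∀ q T n s → 1 ℕ.≤ q → q ℕ.^ n ℕ.≤ suc s →
              toℚ (4 ℕ.* (q ℕ.^ T ℕ.* q ℕ.^ T)) * (1 /ℕ suc s) ≤ toℚ 4 * powℤ q (2 ℕ.* T ℕ.+ 1) (suc n)
  /ℕ-≤-powℤ (suc q) T n s _ q^n≤1+s = ℚₚ.*-cancelʳ-≤-pos (toℚ (Q ℕ.* suc s)) {{toℚ-suc-positive (s ℕ.+ q ℕ.* suc s)}} (begin
    toℚ X * (1 /ℕ suc s) * toℚ (Q ℕ.* suc s)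
      ≡⟨ cong (λ x → toℚ X * (1 /ℕ suc s) * x) (trans (toℚ-* Q (suc s)) (ℚₚ.*-comm (toℚ Q) (toℚ (suc s)))) ⟩
    toℚ X * (1 /ℕ suc s) * (toℚ (suc s) * toℚ Q)
      ≡⟨ solve 4 (λ x r s q → (x :* r) :* (s :* q) := x :* (r :* s) :* q) refl (toℚ X) (1 /ℕ suc s) (toℚ (suc s)) (toℚ Q) ⟩
    toℚ X * (1 /ℕ suc s * toℚ (suc s)) * toℚ Q
      ≡⟨ cong (λ x → toℚ X * x * toℚ Q) (/ℕ-*-toℚ 1 s) ⟩
    toℚ X * 1ℚ * toℚ Q
      ≡⟨ trans (cong (_* toℚ Q) (ℚₚ.*-identityʳ (toℚ X))) (sym (toℚ-* X Q)) ⟩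
    toℚ (X ℕ.* Q)
      ≡⟨ cong toℚ 4Q^2T*Q≡ ⟩
    toℚ (4 ℕ.* Q ℕ.^ (2 ℕ.* T ℕ.+ 1))
      ≡⟨ toℚ-* 4 (Q ℕ.^ (2 ℕ.* T ℕ.+ 1)) ⟩
    toℚ 4 * toℚ (Q ℕ.^ (2 ℕ.* T ℕ.+ 1))
      ≡⟨ cong (toℚ 4 *_) (powℤ-*-^ Q (2 ℕ.* T ℕ.+ 1) (suc n) (ℕ.s≤s ℕ.z≤n)) ⟨
    toℚ 4 * (p * toℚ (Q ℕ.^ suc n))
      ≤⟨ ℚₚ.*-monoˡ-≤-nonNeg (toℚ 4) {{toℚ-nonNegative 4}}
           (ℚₚ.*-monoˡ-≤-nonNeg p {{p-nonNegative}} (toℚ-mono-≤ (ℕₚ.*-monoʳ-≤ Q q^n≤1+s))) ⟩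
    toℚ 4 * (p * toℚ (Q ℕ.* suc s))
      ≡⟨ ℚₚ.*-assoc (toℚ 4) p (toℚ (Q ℕ.* suc s)) ⟨
    toℚ 4 * p * toℚ (Q ℕ.* suc s) ∎)
    where
    open ℚₚ.≤-Reasoning
    Q = suc q
    X = 4 ℕ.* (Q ℕ.^ T ℕ.* Q ℕ.^ T)
    p = powℤ Q (2 ℕ.* T ℕ.+ 1) (suc n)
    p-nonNegative : NonNegative p
    p-nonNegative with suc n ℕ.≤? 2 ℕ.* T ℕ.+ 1
    ... | yes _ = /ℕ-nonNegative (Q ℕ.^ (2 ℕ.* T ℕ.+ 1 ℕ.∸ suc n)) 1
    ... | no  _ = /ℕ-nonNegative 1 (Q ℕ.^ (suc n ℕ.∸ (2 ℕ.* T ℕ.+ 1)))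
    4Q^2T*Q≡ : X ℕ.* Q ≡ 4 ℕ.* Q ℕ.^ (2 ℕ.* T ℕ.+ 1)
    4Q^2T*Q≡ = trans (ℕₚ.*-assoc 4 (Q ℕ.^ T ℕ.* Q ℕ.^ T) Q) (cong (4 ℕ.*_) (q^T*q^T*q≡q^[2T+1] Q T))


module GeometricSum where

  open import Data.Nat as ℕ using (zero; suc; _≤_; z≤n; s≤s; _^_; _+_; _*_)
  import Data.Nat.Properties as ℕₚ
  open import Data.Nat.Solver using (module +-*-Solver)
  open +-*-Solver using (solve; _:=_; _:+_; _:*_; con)
  open import Data.Nat.ListAction using (sum)
  open import Data.Nat.ListAction.Properties using (sum-++)
  open import Data.List using (map; upTo; [_])
  import Data.List.Properties as Listₚ
  open import Relation.Binary.PropositionalEquality hiding ([_])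

  sum-^-≤ : ∀ x → 2 ≤ x → ∀ T → sum (map (x ^_) (map suc (upTo T))) + 2 ≤ 2 * x ^ T
  sum-^-≤ x 2≤x zero    = s≤s (s≤s z≤n)
  sum-^-≤ x 2≤x (suc T) = begin
    sum (map (x ^_) (map suc (upTo (suc T)))) + 2
      ≡⟨ cong (_+ 2) sum-snoc ⟩
    (Σ + (x ^ suc T + 0)) + 2
      ≡⟨ solve 3 (λ a b c → (a :+ (b :+ con 0)) :+ c := (a :+ c) :+ b) refl Σ (x ^ suc T) 2 ⟩
    (Σ + 2) + x ^ suc T
      ≤⟨ ℕₚ.+-monoˡ-≤ (x ^ suc T) (sum-^-≤ x 2≤x T) ⟩
    2 * x ^ T + x ^ suc T
      ≤⟨ ℕₚ.+-monoˡ-≤ (x ^ suc T) (ℕₚ.*-monoˡ-≤ (x ^ T) 2≤x) ⟩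
    x ^ suc T + x ^ suc T
      ≡⟨ solve 1 (λ y → y :+ y := con 2 :* y) refl (x ^ suc T) ⟩
    2 * x ^ suc T                                  ∎
    where
    open ℕₚ.≤-Reasoning
    Σ = sum (map (x ^_) (map suc (upTo T)))
    sum-snoc : sum (map (x ^_) (map suc (upTo (suc T)))) ≡ Σ + (x ^ suc T + 0)
    sum-snoc = trans (cong (λ l → sum (map (x ^_) (map suc l))) (sym (Listₚ.applyUpTo-∷ʳ (λ i → i) T)))
               (trans (cong (λ l → sum (map (x ^_) l)) (Listₚ.map-++ suc (upTo T) [ T ]))
               (trans (cong sum (Listₚ.map-++ (x ^_) (map suc (upTo T)) [ suc T ]))
                      (sum-++ (map (x ^_) (map suc (upTo T))) [ x ^ suc T ])))


module MeanEstimate (K : FiniteField) where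

  open import Data.Nat as ℕ using (ℕ; zero; suc; _≤_; _<_; z≤n; s≤s; _∸_; _^_)
  import Data.Nat.Properties as ℕₚ
  open import Data.Nat.Solver using (module +-*-Solver)
  open import Data.Nat.ListAction using (sum)
  open import Data.List using (List; map; upTo; filter; foldr)
  import Data.List.Properties as Listₚ
  open import Data.List.Membership.Propositional using (_∈_)
  open import Data.List.Membership.Propositional.Properties using (∈-filter⁻; ∈-map⁻; ∈-upTo⁻)
  open import Data.Vec using (Vec)
  open import Data.Product using (Σ; _×_; _,_; proj₂)
  open import Data.Rational as ℚ using (∣_∣; _-_)
  import Data.Rational.Properties as ℚₚ
  open import Relation.Nullary.Decidable using (_×-dec_)
  open import Relation.Binary.PropositionalEquality
  open FiniteField K using (F)
  open Poly K hiding (_∣_)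
  open Counting
  open Sums
  open MonicEnumeration K
  open SquareFreeCount K
  open MultiplesCount K
  open Within
  open RationalEstimates
  open GeometricSum
  open Quantities K

  within-#P-∣ : ∀ {d-1} (g : Vec F (suc d-1)) → Irreducible g → ∀ n → suc d-1 ≤ n →
                Within (2 ℕ.* q ^ suc d-1) ((q ^ suc d-1 ℕ.+ 1) ℕ.* #P-∣ g n) (q-1 ℕ.* q ^ (n ∸ 1))
  within-#P-∣ {d-1} g irr n d≤n =
    subst (λ Q → Within (2 ℕ.* Q ^ d) ((Q ^ d ℕ.+ 1) ℕ.* #P-∣ g n) (q-1 ℕ.* Q ^ (n ∸ 1))) (sym q≡1+[q-1])
      (subst₂ (λ a b → Within (2 ℕ.* suc q-1 ^ d) ((suc q-1 ^ d ℕ.+ 1) ℕ.* a) b)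
              (sym (#P-∣-≥ g irr n d≤n)) W[n-d]≡ (R.within (n ∸ d)))
    where
    d = suc d-1
    #P-suc-suc′ : ∀ m → #P (suc (suc m)) ≡ q-1 ℕ.* suc q-1 ^ suc m
    #P-suc-suc′ m = subst (λ Q → #P (suc (suc m)) ≡ q-1 ℕ.* Q ^ suc m) q≡1+[q-1] (#P-suc-suc m)
    #P-∤-< : ∀ m → m < d → #P-∤ g m ≡ #P m
    #P-∤-< m m<d = sym (trans (#P≡#P-∣+#P-∤ g m) (cong (ℕ._+ #P-∤ g m) (#P-∣-< g m m<d)))
    #P-∤-≥ : ∀ m → d ≤ m → #P-∤ g m ℕ.+ #P-∤ g (m ∸ d) ≡ #P m
    #P-∤-≥ m d≤m = sym (trans (#P≡#P-∣+#P-∤ g m)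
                         (trans (cong (ℕ._+ #P-∤ g m) (#P-∣-≥ g irr m d≤m)) (ℕₚ.+-comm (#P-∤ g (m ∸ d)) (#P-∤ g m))))
    module R = ReflectedRecurrence q-1 d-1 (#P-∤ g) #P #P-0 #P-1 #P-suc-suc′ #P-∤-< #P-∤-≥
    Q = suc q-1
    W[n-d]≡ : Q ^ d-1 ℕ.* (q-1 ℕ.* Q ^ (n ∸ d)) ≡ q-1 ℕ.* Q ^ (n ∸ 1)
    W[n-d]≡ = begin
      Q ^ d-1 ℕ.* (q-1 ℕ.* Q ^ (n ∸ d))   ≡⟨ ℕₚ.*-assoc (Q ^ d-1) q-1 _ ⟨
      Q ^ d-1 ℕ.* q-1 ℕ.* Q ^ (n ∸ d)     ≡⟨ cong (ℕ._* Q ^ (n ∸ d)) (ℕₚ.*-comm (Q ^ d-1) q-1) ⟩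
      q-1 ℕ.* Q ^ d-1 ℕ.* Q ^ (n ∸ d)     ≡⟨ ℕₚ.*-assoc q-1 (Q ^ d-1) _ ⟩
      q-1 ℕ.* (Q ^ d-1 ℕ.* Q ^ (n ∸ d))   ≡⟨ cong (q-1 ℕ.*_) (ℕₚ.^-distribˡ-+-* Q d-1 (n ∸ d)) ⟨
      q-1 ℕ.* Q ^ (d-1 ℕ.+ (n ∸ d))       ≡⟨ cong (λ e → q-1 ℕ.* Q ^ e) (d-1+[n-d]≡n-1 n d≤n) ⟩
      q-1 ℕ.* Q ^ (n ∸ 1)                 ∎
      where
      open ≡-Reasoning
      d-1+[n-d]≡n-1 : ∀ n → d ≤ n → d-1 ℕ.+ (n ∸ d) ≡ n ∸ 1
      d-1+[n-d]≡n-1 (suc n) (s≤s d-1≤n) = ℕₚ.m+[n∸m]≡n d-1≤n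

  irreducibles : ∀ d → List (Vec F d)
  irreducibles d = filter irreducible? (allMonic d)

  #P-∣-irreducibles : ℕ → ℕ → ℕ
  #P-∣-irreducibles n d = sum (map (λ g → #P-∣ g n) (irreducibles d))

  within-#P-∣-irreducibles : ∀ d-1 n → suc d-1 ≤ n →
    Within (π (suc d-1) ℕ.* (2 ℕ.* q ^ suc d-1))
           ((q ^ suc d-1 ℕ.+ 1) ℕ.* #P-∣-irreducibles n (suc d-1))
           (π (suc d-1) ℕ.* (q-1 ℕ.* q ^ (n ∸ 1)))
  within-#P-∣-irreducibles d-1 n d≤n =
    subst₂ (λ B u → Within B ((q ^ d ℕ.+ 1) ℕ.* #P-∣-irreducibles n d) u)
           (sum-const (2 ℕ.* q ^ d) (irreducibles d)) (sum-const (q-1 ℕ.* q ^ (n ∸ 1)) (irreducibles d))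
      (subst (λ x → Within (sum (map (λ _ → 2 ℕ.* q ^ d) (irreducibles d))) x (sum (map (λ _ → q-1 ℕ.* q ^ (n ∸ 1)) (irreducibles d))))
             (sum-*ˡ (q ^ d ℕ.+ 1) (λ g → #P-∣ g n) (irreducibles d))
        (within-sum (λ _ → 2 ℕ.* q ^ d) (λ g → (q ^ d ℕ.+ 1) ℕ.* #P-∣ g n) (λ _ → q-1 ℕ.* q ^ (n ∸ 1)) (irreducibles d)
          (λ g g∈ → within-#P-∣ g (proj₂ (∈-filter⁻ irreducible? {xs = allMonic d} g∈)) n d≤n)))
    where d = suc d-1

  π≤q^d : ∀ d → π d ≤ q ^ d
  π≤q^d d = ℕₚ.≤-trans (Listₚ.length-filter irreducible? (allMonic d)) (ℕₚ.≤-reflexive (length-allMonic d))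

  -- Swap the sums over f and over g; the degree-0 term vanishes as there is no irreducible of degree 0.
  sum-ω : ∀ t n → sum (map (ω t) (P n)) ≡ sum (map (#P-∣-irreducibles n) (map suc (upTo t)))
  sum-ω t n = begin
    sum (map (ω t) (P n))
      ≡⟨ sum-comm (λ d (f : Vec F n) → divisors d f) (upTo (suc t)) (P n) ⟩
    sum (map (λ d → sum (map (λ f → divisors d f) (P n))) (upTo (suc t)))
      ≡⟨ sum-cong (upTo (suc t)) (λ d _ → count-pairs d) ⟩
    sum (map (#P-∣-irreducibles n) (upTo (suc t)))
      ≡⟨ cong (λ l → sum (map (#P-∣-irreducibles n) l)) (Listₚ.map-applyUpTo (λ i → i) suc t) ⟨
    sum (map (#P-∣-irreducibles n) (map suc (upTo t)))                       ∎
    where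
    open ≡-Reasoning
    divisors : ℕ → ∀ {n} → Vec F n → ℕ
    divisors d f = count (λ g → irreducible? g ×-dec g ∣? f) (allMonic d)
    count-pairs : ∀ d → sum (map (λ f → divisors d f) (P n)) ≡ #P-∣-irreducibles n d
    count-pairs d = trans (sum-count-comm (λ g f → irreducible? g ×-dec g ∣? f) (allMonic d) (P n))
                    (trans (sum-count-filter irreducible? (λ g f → g ∣? f) (allMonic d) (P n))
                    (sum-cong (irreducibles d) (λ g _ → count-filter squareFree? (λ f → g ∣? f) (allMonic n))))

  private
    1≤q-1 : 1 ≤ q-1
    1≤q-1 = ℕₚ.≤-pred (subst (2 ≤_) q≡1+[q-1] 2≤q)

    q^d*q^d : ℕ → ℕ
    q^d*q^d d = q ^ d ℕ.* q ^ d

  sum-q^d*q^d : ∀ t → sum (map (λ d → 2 ℕ.* q^d*q^d d) (map suc (upTo t))) ≤ 4 ℕ.* q^d*q^d t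
  sum-q^d*q^d t = begin
    sum (map (λ d → 2 ℕ.* q^d*q^d d) ds)
      ≡⟨ sum-*ˡ 2 q^d*q^d ds ⟩
    2 ℕ.* sum (map q^d*q^d ds)
      ≡⟨ cong (2 ℕ.*_) (sum-cong ds (λ d _ → q^d*q^d≡q²^d d)) ⟩
    2 ℕ.* sum (map ((q ℕ.* q) ^_) ds)
      ≤⟨ ℕₚ.*-monoʳ-≤ 2 (ℕₚ.≤-trans (ℕₚ.m≤m+n _ 2) (sum-^-≤ (q ℕ.* q) 2≤q² t)) ⟩
    2 ℕ.* (2 ℕ.* (q ℕ.* q) ^ t)
      ≡⟨ cong (λ x → 2 ℕ.* (2 ℕ.* x)) (q^d*q^d≡q²^d t) ⟨
    2 ℕ.* (2 ℕ.* q^d*q^d t)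
      ≡⟨ ℕₚ.*-assoc 2 2 (q^d*q^d t) ⟨
    4 ℕ.* q^d*q^d t                          ∎
    where
    open ℕₚ.≤-Reasoning
    ds = map suc (upTo t)
    q^d*q^d≡q²^d : ∀ d → q^d*q^d d ≡ (q ℕ.* q) ^ d
    q^d*q^d≡q²^d zero    = refl
    q^d*q^d≡q²^d (suc d) = trans (+-*-Solver.solve 3 (λ a b c → (a :* b) :* (a :* c) := (a :* a) :* (b :* c)) refl q (q ^ d) (q ^ d))
                                 (cong ((q ℕ.* q) ℕ.*_) (q^d*q^d≡q²^d d))
      where open +-*-Solver using (_:=_; _:*_)
    2≤q² : 2 ≤ q ℕ.* q
    2≤q² = ℕₚ.≤-trans 2≤q (ℕₚ.m≤m*n q q {{ℕ.>-nonZero (ℕₚ.≤-trans (s≤s z≤n) 2≤q)}})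

  μ≡sumℚ : ∀ t n s → #P n ≡ suc s → μ t n ≡ sumℚ (map suc (upTo t)) (λ d → #P-∣-irreducibles n d /ℕ suc s)
  μ≡sumℚ t n s #P≡ = trans (cong₂ _/ℕ_ (sum-ω t n) #P≡) (sum-/ℕ (map suc (upTo t)) (#P-∣-irreducibles n) s)

  mainTerm≡sumℚ : ∀ t → mainTerm t ≡ sumℚ (map suc (upTo t)) (λ d → π d /ℕ suc (q ^ d))
  mainTerm≡sumℚ t = cong (foldr ℚ._+_ ℚ.0ℚ) (Listₚ.map-cong (λ d → cong (π d /ℕ_) (ℕₚ.+-comm (q ^ d) 1)) (map suc (upTo t)))

  -- Each degree d contributes an error of at most π(d) 2 q^d / ((q^d + 1) #P n) ≤ 2 q^(2d) / #P n.
  ∣#P-∣-irreducibles-π∣≤ : ∀ n s → #P n ≡ suc s → q-1 ℕ.* q ^ (n ∸ 1) ≡ suc s → ∀ d-1 → suc d-1 ≤ n →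
    ℚ._≤_ ∣ #P-∣-irreducibles n (suc d-1) /ℕ suc s - π (suc d-1) /ℕ suc (q ^ suc d-1) ∣
          (toℚ (2 ℕ.* q^d*q^d (suc d-1)) ℚ.* (1 /ℕ suc s))
  ∣#P-∣-irreducibles-π∣≤ n s _ #P≡ d-1 d≤n =
    ∣/ℕ-/ℕ∣≤ (#P-∣-irreducibles n d) (π d) s (q ^ d) (π d ℕ.* (2 ℕ.* q ^ d)) (2 ℕ.* q^d*q^d d)
      (subst₂ (λ a b → Within (π d ℕ.* (2 ℕ.* q ^ d)) (a ℕ.* #P-∣-irreducibles n d) (π d ℕ.* b))
              (ℕₚ.+-comm (q ^ d) 1) #P≡ (within-#P-∣-irreducibles d-1 n d≤n))
      (begin
        π d ℕ.* (2 ℕ.* q ^ d)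
          ≤⟨ ℕₚ.*-monoˡ-≤ (2 ℕ.* q ^ d) (π≤q^d d) ⟩
        q ^ d ℕ.* (2 ℕ.* q ^ d)
          ≡⟨ +-*-Solver.solve 1 (λ x → x :* (con 2 :* x) := con 2 :* (x :* x)) refl (q ^ d) ⟩
        2 ℕ.* q^d*q^d d
          ≤⟨ ℕₚ.m≤m*n (2 ℕ.* q^d*q^d d) (suc (q ^ d)) ⟩
        2 ℕ.* q^d*q^d d ℕ.* suc (q ^ d)           ∎)
    where
    open ℕₚ.≤-Reasoning
    open +-*-Solver using (_:=_; _:*_; con)
    d = suc d-1

  ∣μ-mainTerm∣≤-/ℕ#P : ∀ t n s → t ≤ n → #P n ≡ suc s → q-1 ℕ.* q ^ (n ∸ 1) ≡ suc s →
                       ℚ._≤_ ∣ μ t n - mainTerm t ∣ (toℚ (4 ℕ.* q^d*q^d t) ℚ.* (1 /ℕ suc s))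
  ∣μ-mainTerm∣≤-/ℕ#P t n s t≤n #P≡ #P≡′ = begin
    ∣ μ t n - mainTerm t ∣
      ≡⟨ cong₂ (λ x y → ∣ x - y ∣) (μ≡sumℚ t n s #P≡) (mainTerm≡sumℚ t) ⟩
    ∣ sumℚ ds (λ d → #P-∣-irreducibles n d /ℕ suc s) - sumℚ ds (λ d → π d /ℕ suc (q ^ d)) ∣
      ≤⟨ ∣sumℚ-sumℚ∣≤ ds (λ d → #P-∣-irreducibles n d /ℕ suc s) (λ d → π d /ℕ suc (q ^ d)) (λ d → 2 ℕ.* q^d*q^d d)
                      (1 /ℕ suc s) {{/ℕ-nonNegative 1 (suc s)}} term-bound ⟩
    toℚ (sum (map (λ d → 2 ℕ.* q^d*q^d d) ds)) ℚ.* (1 /ℕ suc s)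
      ≤⟨ ℚₚ.*-monoʳ-≤-nonNeg (1 /ℕ suc s) {{/ℕ-nonNegative 1 (suc s)}} (toℚ-mono-≤ (sum-q^d*q^d t)) ⟩
    toℚ (4 ℕ.* q^d*q^d t) ℚ.* (1 /ℕ suc s) ∎
    where
    open ℚₚ.≤-Reasoning
    ds = map suc (upTo t)
    term-bound : ∀ d → d ∈ ds →
      ℚ._≤_ ∣ #P-∣-irreducibles n d /ℕ suc s - π d /ℕ suc (q ^ d) ∣ (toℚ (2 ℕ.* q^d*q^d d) ℚ.* (1 /ℕ suc s))
    term-bound d d∈ds = bound (∈-map⁻ suc d∈ds)
      where
      bound : (Σ ℕ λ d-1 → d-1 ∈ upTo t × d ≡ suc d-1) →
              ℚ._≤_ ∣ #P-∣-irreducibles n d /ℕ suc s - π d /ℕ suc (q ^ d) ∣ (toℚ (2 ℕ.* q^d*q^d d) ℚ.* (1 /ℕ suc s))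
      bound (d-1 , d-1∈ , d≡) =
        subst (λ d → ℚ._≤_ ∣ #P-∣-irreducibles n d /ℕ suc s - π d /ℕ suc (q ^ d) ∣ (toℚ (2 ℕ.* q^d*q^d d) ℚ.* (1 /ℕ suc s)))
              (sym d≡) (∣#P-∣-irreducibles-π∣≤ n s #P≡ #P≡′ d-1 (ℕₚ.≤-trans (∈-upTo⁻ d-1∈) t≤n))

  ∣μ-mainTerm∣≤ : ∀ t n → t ℕ.+ 2 ≤ n → ℚ._≤_ ∣ μ t n - mainTerm t ∣ (toℚ 4 ℚ.* powℤ q (2 ℕ.* t ℕ.+ 1) n)
  ∣μ-mainTerm∣≤ t n t+2≤n = estimate (1≤⇒suc (#P n) (subst (1 ≤_) (sym #P≡) 1≤q-1*q^n-1))
    where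
    m = n ∸ 2
    n≡m+2 : n ≡ suc (suc m)
    n≡m+2 = trans (sym (ℕₚ.m∸n+n≡m (ℕₚ.≤-trans (ℕₚ.m≤n+m 2 t) t+2≤n))) (ℕₚ.+-comm m 2)
    #P≡ : #P n ≡ q-1 ℕ.* q ^ suc m
    #P≡ = trans (cong #P n≡m+2) (#P-suc-suc m)
    1≤q-1*q^n-1 : 1 ≤ q-1 ℕ.* q ^ suc m
    1≤q-1*q^n-1 = ℕₚ.*-mono-≤ 1≤q-1 (ℕₚ.m^n>0 q {{ℕ.>-nonZero (ℕₚ.≤-trans (s≤s z≤n) 2≤q)}} (suc m))
    1≤⇒suc : ∀ x → 1 ≤ x → Σ ℕ λ s → x ≡ suc s
    1≤⇒suc (suc s) _ = s , refl
    estimate : (Σ ℕ λ s → #P n ≡ suc s) → ℚ._≤_ ∣ μ t n - mainTerm t ∣ (toℚ 4 ℚ.* powℤ q (2 ℕ.* t ℕ.+ 1) n)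
    estimate (s , #P≡suc) =
      ℚₚ.≤-trans (∣μ-mainTerm∣≤-/ℕ#P t n s (ℕₚ.≤-trans (ℕₚ.m≤m+n t 2) t+2≤n) #P≡suc
                    (trans (cong (λ k → q-1 ℕ.* q ^ (k ∸ 1)) n≡m+2) q-1*q^n-1≡))
                 (subst (λ k → ℚ._≤_ (toℚ (4 ℕ.* q^d*q^d t) ℚ.* (1 /ℕ suc s)) (toℚ 4 ℚ.* powℤ q (2 ℕ.* t ℕ.+ 1) k))
                        (sym n≡m+2)
                        (/ℕ-≤-powℤ q t (suc m) s (ℕₚ.≤-trans (s≤s z≤n) 2≤q)
                          (subst (q ^ suc m ≤_) q-1*q^n-1≡ (ℕₚ.m≤n*m (q ^ suc m) q-1 {{ℕ.>-nonZero 1≤q-1}}))))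
      where
      q-1*q^n-1≡ : q-1 ℕ.* q ^ suc m ≡ suc s
      q-1*q^n-1≡ = trans (sym #P≡) #P≡suc


open import Data.Nat using (ℕ; _≤_; _∸_; _*_; _+_; _%_)
open import Data.Product using (Σ; _,_; proj₁; proj₂)
open import Data.Rational using (ℚ; ∣_∣; _-_)
open import Relation.Binary.PropositionalEquality using (_≡_; subst)
import Data.Nat.Properties as ℕₚ
open import Data.Empty using (⊥)

2≤n∸t⇒t+2≤n : ∀ {n t} → 2 ≤ n ∸ t → t + 2 ≤ n
2≤n∸t⇒t+2≤n {n} {t} 2≤n∸t =
  subst (_≤ n) (ℕₚ.+-comm 2 t) (ℕₚ.m≤o∸n⇒m+n≤o 2 (ℕₚ.<⇒≤ (ℕₚ.m∸n≢0⇒n<m n∸t≢0)) 2≤n∸t)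
  where
  n∸t≢0 : n ∸ t ≡ 0 → ⊥
  n∸t≢0 n∸t≡0 with subst (2 ≤_) n∸t≡0 2≤n∸t
  ... | ()

proposition5p2 : (K : FiniteField) → FiniteField.order K % 2 ≡ 1 →
    (T : ℕ → ℕ) → TendsToInfinity T → TendsToInfinity (λ n → n ∸ T n) →
    Σ ℚ λ C → Σ ℕ λ N → ∀ n → N ≤ n →
      Data.Rational._≤_
        ∣ Quantities.μ K (T n) n - Quantities.mainTerm K (T n) ∣
        (Data.Rational._*_ C (powℤ (FiniteField.order K) (2 * T n + 1) n))
proposition5p2 K _ T _ n∸T→∞ =
  RationalEstimates.toℚ 4 , proj₁ (n∸T→∞ 2) ,
  λ n N≤n → MeanEstimate.∣μ-mainTerm∣≤ K (T n) n (2≤n∸t⇒t+2≤n (proj₂ (n∸T→∞ 2) n N≤n))
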